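{- There is a constant $c>0$ such that for each positive integer $r$, $q_r^-(n)\ge c/\sqrt r$ for every sufficiently large $n$ with $rn$ even, where $q_r^-(n)=\min\{q^*(G): G \text{ an } r\text{ -regular graph on } n \text{ vertices}\}$.
   Context: For a graph $G$ with $m\ge 1$ edges and a partition $\mathcal A$ of $V(G)$, $q_{\mathcal A}(G)=\frac1m\sum_{A\in\mathcal A} e(A) - \frac{1}{4m^2}\sum_{A\in\mathcal A}\mathrm{vol}(A)^2$, where $e(A)$ is the number of edges inside $A$ and $\mathrm{vol}(A)$ the sum of degrees of vertices in $A$; the modularity is $q^*(G)=\max_{\mathcal A} q_{\mathcal A}(G)$. Graphs are simple. -}

module Defs where

open import Data.Bool using (Bool; true; false; _∧_; if_then_else_)
open import Data.Nat as ℕ using (ℕ; zero; suc)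
open import Data.Fin using (Fin; zero; suc; toℕ)
open import Data.Fin.Properties using (_≟_)
open import Data.Nat.Properties using (_<?_)
open import Data.Integer using (+_)
open import Data.Rational using (ℚ; _/_; 0ℚ; _*_; _-_; _≤_)
open import Data.Product using (_×_)
open import Relation.Binary.PropositionalEquality using (_≡_)
open import Relation.Nullary.Decidable using (⌊_⌋)

Σ : (n : ℕ) → (Fin n → ℕ) → ℕ
Σ zero    f = 0
Σ (suc n) f = f zero ℕ.+ Σ n (λ i → f (suc i))

record Graph (n : ℕ) : Set where
  field
    adj    : Fin n → Fin n → Bool
    sym    : ∀ i j → adj i j ≡ adj j i
    irrefl : ∀ i → adj i i ≡ false
open Graph public

[_] : Bool → ℕ
[ true ]  = 1
[ false ] = 0

deg : ∀ {n} → Graph n → Fin n → ℕ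
deg {n} G i = Σ n (λ j → [ adj G i j ])

edges : ∀ {n} → Graph n → ℕ
edges {n} G = Σ n (λ i → Σ n (λ j → [ ⌊ toℕ i <? toℕ j ⌋ ∧ adj G i j ]))

Regular : ∀ {n} → Graph n → ℕ → Set
Regular {n} G r = ∀ i → deg G i ≡ r

-- a partition of Fin n given by a labelling with labels in Fin n;
-- the parts are the nonempty fibres (empty fibres contribute 0 below)
Partition : ℕ → Set
Partition n = Fin n → Fin n

eIn : ∀ {n} → Graph n → Partition n → ℕ
eIn {n} G P = Σ n (λ i → Σ n (λ j →
  [ ⌊ toℕ i <? toℕ j ⌋ ∧ (adj G i j ∧ ⌊ P i ≟ P j ⌋) ]))

vol : ∀ {n} → Graph n → Partition n → Fin n → ℕ
vol {n} G P k = Σ n (λ i → if ⌊ P i ≟ k ⌋ then deg G i else 0)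

sumVolSq : ∀ {n} → Graph n → Partition n → ℕ
sumVolSq {n} G P = Σ n (λ k → vol G P k ℕ.* vol G P k)

toℚ : ℕ → ℚ
toℚ k = (+ k) / 1

-- 1/k, with the convention 1/0 = 0 (only used for m ≥ 1)
inv : ℕ → ℚ
inv zero    = 0ℚ
inv (suc k) = (+ 1) / suc k

q : ∀ {n} → Graph n → Partition n → ℚ
q G P = (inv m * toℚ (eIn G P)) - (inv (4 ℕ.* m ℕ.* m) * toℚ (sumVolSq G P))
  where m = edges G

-- "c / √r ≤ x" for c > 0, expressed without square roots
_/√_≤_ : ℚ → ℕ → ℚ → Set
c /√ r ≤ x = (0ℚ ≤ x) × (c * c ≤ (x * x) * toℚ r)

{-# OPTIONS --safe #-}
-- Take a cut b₀ containing at least half of the rn/2 edges, which exists by averaging over all cuts.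
-- For a uniformly random sign vector y, let the vertices on the right of the cut keep their sign and
-- let every left vertex take the majority sign of its right neighbours.  The resulting bipartition
-- has modularity (n A − r s²) / (2 r n²), where A is the number of agreeing minus disagreeing edges
-- counted twice and s is the signed class imbalance.  By anti-concentration of a ±1 sum of k ≤ r
-- terms (second and fourth moments), a left vertex gains k / 4√r agreements in expectation, while
-- Harris' inequality shows that all remaining edge correlations are nonnegative; hence 𝔼 A ≳ r n / √r.
-- By the Efron–Stein inequality 𝔼 s² = O(n r²), which is negligible once n ≫ r^{5/2}.  Some y attains
-- the expectation, giving a partition of modularity ≳ 1 / √r.
module Submission where

module RegularGraphModularity where

  open import Defs hiding (sym)
  open import Data.Bool as Bool using (Bool; true; false; not; if_then_else_; _∧_)
  open import Data.Bool.Properties using (if-float; not-involutive)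
    renaming (≤-refl to ≤ᵇ-refl; ≤-minimum to ≤ᵇ-minimum; ≤-maximum to ≤ᵇ-maximum)
  open import Data.Empty using (⊥-elim)
  open import Data.Fin using (Fin; zero; suc; toℕ)
  open import Data.Fin.Properties using (_≟_; toℕ-injective)
  open import Data.Integer as ℤ
    using (ℤ; +_; -[1+_]; +[1+_]; _+_; _*_; -_; _-_; _≤_; _<_; +≤+; -≤+; +<+; ∣_∣; Positive)
  open import Data.Integer.Properties hiding (_≟_)
  open import Algebra.Properties.Semiring.Sum +-*-semiring
    using (sum; sum-syntax; sum-cong-≗; sum-replicate-zero; ∑-distrib-+; ∑-comm; *-distribˡ-sum)
  open import Algebra.Properties.CommutativeSemigroup +-commutativeSemigroup
    using () renaming (interchange to +-interchange)
  open import Data.Integer.Tactic.RingSolver using (solve-∀)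
  open import Data.Nat as ℕ using (ℕ; zero; suc; z≤n; s≤s)
  import Data.Nat.Properties as ℕ
  open import Data.Nat.Tactic.RingSolver using () renaming (solve-∀ to ℕ-solve-∀)
  open import Data.Product using (∃-syntax; _×_; _,_; proj₁; proj₂; uncurry)
  open import Data.Rational as ℚ using (ℚ; 0ℚ; toℚᵘ)
  import Data.Rational.Properties as ℚ
  open import Data.Rational.Unnormalised as ℚᵘ using (mkℚᵘ; *≤*; *≡*)
  import Data.Rational.Unnormalised.Properties as ℚᵘ
  open import Data.Sum using (_⊎_; inj₁; inj₂; [_,_]′)
  open import Data.Vec using (Vec; []; _∷_; lookup; map; _[_]%=_)
  open import Data.Vec.Properties using (lookup-map; lookup∘updateAt′)
  open import Data.Vec.Relation.Binary.Pointwise.Inductive as Pointwise using (Pointwise; []; _∷_)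
  open import Relation.Binary.PropositionalEquality hiding ([_])
  open import Relation.Nullary using (yes; no)
  open import Relation.Nullary.Decidable using (⌊_⌋)

  0≤+ : ∀ k → + 0 ≤ + k
  0≤+ k = +≤+ ℕ.z≤n

  0≤-* : ∀ {a b} → + 0 ≤ a → + 0 ≤ b → + 0 ≤ a * b
  0≤-* {+ m} {+ n} _ _ = subst (+ 0 ≤_) (pos-* m n) (0≤+ (m ℕ.* n))

  0≤-square : ∀ x → + 0 ≤ x * x
  0≤-square (+ m) = 0≤-* (0≤+ m) (0≤+ m)
  0≤-square -[1+ m ] = 0≤+ _

  ≤-byGap : ∀ {a b} d → + 0 ≤ d → b ≡ a + d → a ≤ b
  ≤-byGap {a} (+ k) _ refl = i≤i+j a (+ k)

  *-monoˡ-≤-0≤ : ∀ c {a b} → + 0 ≤ c → a ≤ b → c * a ≤ c * b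
  *-monoˡ-≤-0≤ (+ k) _ = *-monoˡ-≤-nonNeg (+ k)

  +-≤-split : ∀ {x y a b} → x + y ≤ a + b → x ≤ a ⊎ y ≤ b
  +-≤-split {x} {y} {a} {b} le with x ≤? a
  ... | yes x≤a = inj₁ x≤a
  ... | no  x≰a = inj₂ (0≤i-j⇒j≤i (subst (+ 0 ≤_) (gaps x y a b)
                         (+-mono-≤ (i≤j⇒0≤j-i le) (i≤j⇒0≤j-i (<⇒≤ (≰⇒> x≰a))))))
    where
    gaps : ∀ x y a b → ((a + b) - (x + y)) + (x - a) ≡ b - y
    gaps = solve-∀

  square : ℤ → ℤ
  square x = x * x

  square-∣∣ : ∀ s → square s ≡ square (+ ∣ s ∣)
  square-∣∣ (+ m)    = refl
  square-∣∣ -[1+ m ] = refl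

  square-mono-∣∣ : ∀ x M → + ∣ x ∣ ≤ M → square x ≤ square M
  square-mono-∣∣ x M ∣x∣≤M = subst (_≤ square M) (sym (square-∣∣ x))
    (≤-trans (*-monoˡ-≤-0≤ (+ ∣ x ∣) (0≤+ _) ∣x∣≤M)
             (*-monoʳ-≤-nonNeg′ (≤-trans (0≤+ _) ∣x∣≤M) ∣x∣≤M))
    where
    *-monoʳ-≤-nonNeg′ : ∀ {c a b} → + 0 ≤ c → a ≤ b → a * c ≤ b * c
    *-monoʳ-≤-nonNeg′ {+ k} _ = *-monoʳ-≤-nonNeg (+ k)

  square-mono-0≤ : ∀ {a b} → + 0 ≤ a → a ≤ b → square a ≤ square b
  square-mono-0≤ {a} {b} 0≤a a≤b = square-mono-∣∣ a b (subst (_≤ b) (sym (0≤i⇒+∣i∣≡i 0≤a)) a≤b)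

  ∑-mono : ∀ n {f g : Fin n → ℤ} → (∀ i → f i ≤ g i) → sum f ≤ sum g
  ∑-mono zero    le = ≤-refl
  ∑-mono (suc n) le = +-mono-≤ (le zero) (∑-mono n (λ i → le (suc i)))

  ∑-nonNeg : ∀ n {f : Fin n → ℤ} → (∀ i → + 0 ≤ f i) → + 0 ≤ sum f
  ∑-nonNeg n {f} 0≤f = subst (_≤ sum f) (sum-replicate-zero n) (∑-mono n 0≤f)

  ∑-neg : ∀ n (f : Fin n → ℤ) → ∑[ i < n ] (- f i) ≡ - sum f
  ∑-neg zero    f = refl
  ∑-neg (suc n) f = trans (cong (λ x → - f zero + x) (∑-neg n (λ i → f (suc i))))
                          (sym (neg-distrib-+ (f zero) _))

  ∑-const : ∀ n c → ∑[ i < n ] c ≡ + n * c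
  ∑-const zero    c = sym (*-zeroˡ c)
  ∑-const (suc n) c = begin
    c + ∑[ i < n ] c    ≡⟨ cong (λ x → c + x) (∑-const n c) ⟩
    c + + n * c         ≡⟨ sym (suc-* (+ n) c) ⟩
    + suc n * c         ∎
    where open ≡-Reasoning

  ∣∑∣≤∑∣∣ : ∀ n (f : Fin n → ℤ) → + ∣ sum f ∣ ≤ ∑[ i < n ] (+ ∣ f i ∣)
  ∣∑∣≤∑∣∣ zero    f = ≤-refl
  ∣∑∣≤∑∣∣ (suc n) f = begin
    + ∣ f zero + sum (λ i → f (suc i)) ∣              ≤⟨ +≤+ (∣i+j∣≤∣i∣+∣j∣ (f zero) _) ⟩
    + (∣ f zero ∣ ℕ.+ ∣ sum (λ i → f (suc i)) ∣)       ≡⟨ pos-+ ∣ f zero ∣ _ ⟩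
    + ∣ f zero ∣ + + ∣ sum (λ i → f (suc i)) ∣         ≤⟨ +-monoʳ-≤ (+ ∣ f zero ∣) (∣∑∣≤∑∣∣ n (λ i → f (suc i))) ⟩
    + ∣ f zero ∣ + ∑[ i < n ] (+ ∣ f (suc i) ∣)          ∎
    where open ≤-Reasoning

  𝟙 : Bool → ℤ
  𝟙 b = + [ b ]

  +-Σ : ∀ n (f : Fin n → ℕ) → + Σ n f ≡ ∑[ i < n ] (+ f i)
  +-Σ zero    f = refl
  +-Σ (suc n) f = trans (pos-+ (f zero) _) (cong (λ x → + f zero + x) (+-Σ n (λ i → f (suc i))))

  δ : ∀ {n} → Fin n → Fin n → ℤ
  δ zero    zero    = + 1
  δ zero    (suc _) = + 0
  δ (suc _) zero    = + 0
  δ (suc v) (suc w) = δ v w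

  δ-diag : ∀ {n} (v : Fin n) → δ v v ≡ + 1
  δ-diag zero    = refl
  δ-diag (suc v) = δ-diag v

  δ-≢ : ∀ {n} {v w : Fin n} → v ≢ w → δ v w ≡ + 0
  δ-≢ {v = zero}  {zero}  v≢w = ⊥-elim (v≢w refl)
  δ-≢ {v = zero}  {suc w} _   = refl
  δ-≢ {v = suc v} {zero}  _   = refl
  δ-≢ {v = suc v} {suc w} v≢w = δ-≢ (λ eq → v≢w (cong suc eq))

  ∑-δ : ∀ n (v : Fin n) (g : Fin n → ℤ) → ∑[ w < n ] (δ v w * g w) ≡ g v
  ∑-δ (suc n) zero    g = trans (cong₂ _+_ (*-identityˡ (g zero)) (trans (sum-cong-≗ (λ w → *-zeroˡ (g (suc w)))) (sum-replicate-zero n)))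
                                (+-identityʳ (g zero))
  ∑-δ (suc n) (suc v) g = trans (+-identityˡ _) (∑-δ n v (λ w → g (suc w)))

  ∑-δ-const : ∀ n (v : Fin n) → ∑[ w < n ] δ v w ≡ + 1
  ∑-δ-const n v = trans (sum-cong-≗ (λ w → sym (*-identityʳ (δ v w)))) (∑-δ n v (λ _ → + 1))

  handshake : ∀ n (B : Fin n → Fin n → Bool) → (∀ i j → B i j ≡ B j i) → (∀ i → B i i ≡ false) →
    + 2 * + Σ n (λ i → Σ n (λ j → [ ⌊ toℕ i ℕ.<? toℕ j ⌋ ∧ B i j ])) ≡ ∑[ i < n ] ∑[ j < n ] 𝟙 (B i j)
  handshake n B B-sym B-irrefl = begin
    + 2 * + Σ n (λ i → Σ n (λ j → [ below i j ]))
      ≡⟨ cong (+ 2 *_) (trans (+-Σ n (λ i → Σ n (λ j → [ below i j ]))) (sum-cong-≗ (λ i → +-Σ n (λ j → [ below i j ])))) ⟩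
    + 2 * S
      ≡⟨ double S ⟩
    S + S
      ≡⟨ cong (λ x → S + x) (∑-comm (λ i j → 𝟙 (below i j))) ⟩
    S + ∑[ i < n ] ∑[ j < n ] 𝟙 (below j i)
      ≡⟨ sym (∑-distrib-+ (λ i → ∑[ j < n ] 𝟙 (below i j)) (λ i → ∑[ j < n ] 𝟙 (below j i))) ⟩
    ∑[ i < n ] (∑[ j < n ] 𝟙 (below i j) + ∑[ j < n ] 𝟙 (below j i))
      ≡⟨ sum-cong-≗ (λ i → sym (∑-distrib-+ (λ j → 𝟙 (below i j)) (λ j → 𝟙 (below j i)))) ⟩
    ∑[ i < n ] ∑[ j < n ] (𝟙 (below i j) + 𝟙 (below j i))
      ≡⟨ sum-cong-≗ (λ i → sum-cong-≗ (λ j → sym (split i j))) ⟩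
    ∑[ i < n ] ∑[ j < n ] 𝟙 (B i j) ∎
    where
    open ≡-Reasoning
    below : Fin n → Fin n → Bool
    below i j = ⌊ toℕ i ℕ.<? toℕ j ⌋ ∧ B i j
    S = ∑[ i < n ] ∑[ j < n ] 𝟙 (below i j)
    double : ∀ x → + 2 * x ≡ x + x
    double = solve-∀
    split : ∀ i j → 𝟙 (B i j) ≡ 𝟙 (below i j) + 𝟙 (below j i)
    split i j with toℕ i ℕ.<? toℕ j | toℕ j ℕ.<? toℕ i
    ... | yes i<j | yes j<i = ⊥-elim (ℕ.<-asym i<j j<i)
    ... | yes _   | no _    = sym (+-identityʳ _)
    ... | no _    | yes _   = trans (cong 𝟙 (B-sym i j)) (sym (+-identityˡ _))
    ... | no i≮j  | no j≮i  = cong 𝟙 (trans (cong (B i) (sym i≡j)) (B-irrefl i))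
      where
      i≡j : i ≡ j
      i≡j = toℕ-injective (ℕ.≤-antisym (ℕ.≮⇒≥ j≮i) (ℕ.≮⇒≥ i≮j))

  -- Sums over the discrete cube

  cubeSize : ℕ → ℤ
  cubeSize n = + (2 ℕ.^ n)

  cubeSize-positive : ∀ n → Positive (cubeSize n)
  cubeSize-positive n = ℤ.positive (+<+ (ℕ.m^n>0 2 n))

  0≤cubeSize : ∀ n → + 0 ≤ cubeSize n
  0≤cubeSize n = 0≤+ (2 ℕ.^ n)

  cubeSize-suc : ∀ n → cubeSize (suc n) ≡ cubeSize n + cubeSize n
  cubeSize-suc n = trans (cong (λ k → + (2 ℕ.^ n ℕ.+ k)) (ℕ.+-identityʳ (2 ℕ.^ n)))
                         (pos-+ (2 ℕ.^ n) (2 ℕ.^ n))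

  -- cubeSum n F = 2ⁿ 𝔼 F for y uniform on the cube; all expectations are kept in this unnormalised form.
  cubeSum : ∀ n → (Vec Bool n → ℤ) → ℤ
  cubeSum zero    F = F []
  cubeSum (suc n) F = cubeSum n (λ y → F (true ∷ y)) + cubeSum n (λ y → F (false ∷ y))

  cubeSum-cong : ∀ n {F G : Vec Bool n → ℤ} → (∀ y → F y ≡ G y) → cubeSum n F ≡ cubeSum n G
  cubeSum-cong zero    eq = eq []
  cubeSum-cong (suc n) eq = cong₂ _+_ (cubeSum-cong n (λ y → eq (true ∷ y)))
                                      (cubeSum-cong n (λ y → eq (false ∷ y)))

  cubeSum-mono : ∀ n {F G : Vec Bool n → ℤ} → (∀ y → F y ≤ G y) → cubeSum n F ≤ cubeSum n G
  cubeSum-mono zero    le = le []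
  cubeSum-mono (suc n) le = +-mono-≤ (cubeSum-mono n (λ y → le (true ∷ y)))
                                     (cubeSum-mono n (λ y → le (false ∷ y)))

  cubeSum-+ : ∀ n (F G : Vec Bool n → ℤ) → cubeSum n (λ y → F y + G y) ≡ cubeSum n F + cubeSum n G
  cubeSum-+ zero    F G = refl
  cubeSum-+ (suc n) F G =
    trans (cong₂ _+_ (cubeSum-+ n (λ y → F (true ∷ y)) (λ y → G (true ∷ y)))
                     (cubeSum-+ n (λ y → F (false ∷ y)) (λ y → G (false ∷ y))))
          (+-interchange (cubeSum n (λ y → F (true ∷ y))) _ _ _)

  cubeSum-*ˡ : ∀ n c (F : Vec Bool n → ℤ) → cubeSum n (λ y → c * F y) ≡ c * cubeSum n F
  cubeSum-*ˡ zero    c F = refl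
  cubeSum-*ˡ (suc n) c F = trans (cong₂ _+_ (cubeSum-*ˡ n c _) (cubeSum-*ˡ n c _))
                                 (sym (*-distribˡ-+ c _ _))

  cubeSum-neg : ∀ n (F : Vec Bool n → ℤ) → cubeSum n (λ y → - F y) ≡ - cubeSum n F
  cubeSum-neg zero    F = refl
  cubeSum-neg (suc n) F = trans (cong₂ _+_ (cubeSum-neg n _) (cubeSum-neg n _))
                                (sym (neg-distrib-+ (cubeSum n (λ y → F (true ∷ y))) _))

  cubeSum-const : ∀ n c → cubeSum n (λ _ → c) ≡ cubeSize n * c
  cubeSum-const zero    c = sym (*-identityˡ c)
  cubeSum-const (suc n) c = begin
    cubeSum n (λ _ → c) + cubeSum n (λ _ → c)   ≡⟨ cong₂ _+_ (cubeSum-const n c) (cubeSum-const n c) ⟩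
    cubeSize n * c + cubeSize n * c             ≡⟨ sym (*-distribʳ-+ c (cubeSize n) (cubeSize n)) ⟩
    (cubeSize n + cubeSize n) * c               ≡⟨ cong (_* c) (sym (cubeSize-suc n)) ⟩
    cubeSize (suc n) * c                        ∎
    where open ≡-Reasoning

  cubeSum-∑ : ∀ n k (F : Fin k → Vec Bool n → ℤ) →
              cubeSum n (λ y → ∑[ i < k ] F i y) ≡ ∑[ i < k ] cubeSum n (F i)
  cubeSum-∑ n zero    F = trans (cubeSum-const n (+ 0)) (*-zeroʳ (cubeSize n))
  cubeSum-∑ n (suc k) F = trans (cubeSum-+ n _ _)
                                (cong (λ x → cubeSum n (F zero) + x) (cubeSum-∑ n k (λ i → F (suc i))))

  cubeSum-average : ∀ n (F : Vec Bool n → ℤ) t → cubeSize n * t ≤ cubeSum n F → ∃[ y ] t ≤ F y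
  cubeSum-average zero    F t le = [] , subst (_≤ F []) (*-identityˡ t) le
  cubeSum-average (suc n) F t le with +-≤-split (subst (_≤ cubeSum (suc n) F) split-t le)
    where
    split-t : cubeSize (suc n) * t ≡ cubeSize n * t + cubeSize n * t
    split-t = trans (cong (_* t) (cubeSize-suc n)) (*-distribʳ-+ t (cubeSize n) (cubeSize n))
  ... | inj₁ le₁ = let y , t≤F = cubeSum-average n _ t le₁ in true  ∷ y , t≤F
  ... | inj₂ le₀ = let y , t≤F = cubeSum-average n _ t le₀ in false ∷ y , t≤F

  spin : Bool → ℤ
  spin true  = + 1
  spin false = - + 1

  spin-not : ∀ b → spin (not b) ≡ - spin b
  spin-not true  = refl
  spin-not false = refl

  spin-mono : ∀ {b b′} → b Bool.≤ b′ → spin b ≤ spin b′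
  spin-mono Bool.f≤t = -≤+
  spin-mono Bool.b≤b = ≤-refl

  ∣spin-spin∣≤2 : ∀ b b′ → + ∣ spin b - spin b′ ∣ ≤ + 2
  ∣spin-spin∣≤2 true  true  = 0≤+ 2
  ∣spin-spin∣≤2 true  false = ≤-refl
  ∣spin-spin∣≤2 false true  = ≤-refl
  ∣spin-spin∣≤2 false false = 0≤+ 2

  spinSum : ∀ {n} → (Fin n → ℤ) → Vec Bool n → ℤ
  spinSum {n} a y = ∑[ i < n ] (a i * spin (lookup y i))

  spinSum-δ : ∀ {n} (v : Fin n) y → spinSum (δ v) y ≡ spin (lookup y v)
  spinSum-δ {n} v y = ∑-δ n v (λ w → spin (lookup y w))

  spinSum-not : ∀ {n} (c : Fin n → ℤ) y → spinSum c (map not y) ≡ - spinSum c y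
  spinSum-not {n} c y = begin
    ∑[ i < n ] (c i * spin (lookup (map not y) i)) ≡⟨ sum-cong-≗ (λ i → cong (λ b → c i * spin b) (lookup-map i not y)) ⟩
    ∑[ i < n ] (c i * spin (not (lookup y i)))     ≡⟨ sum-cong-≗ (λ i → trans (cong (c i *_) (spin-not (lookup y i))) (sym (neg-distribʳ-* (c i) _))) ⟩
    ∑[ i < n ] (- (c i * spin (lookup y i)))       ≡⟨ ∑-neg n _ ⟩
    - spinSum c y                                  ∎
    where open ≡-Reasoning

  cubeSum-spinSum-* : ∀ n (a b : Fin n → ℤ) →
    cubeSum n (λ y → spinSum a y * spinSum b y) ≡ cubeSize n * ∑[ i < n ] (a i * b i)
  cubeSum-spinSum-* zero    a b = refl
  cubeSum-spinSum-* (suc n) a b = begin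
    cubeSum n (λ y → (a₀ * + 1 + A y) * (b₀ * + 1 + B y)) + cubeSum n (λ y → (a₀ * - + 1 + A y) * (b₀ * - + 1 + B y))
      ≡⟨ sym (cubeSum-+ n _ _) ⟩
    cubeSum n (λ y → (a₀ * + 1 + A y) * (b₀ * + 1 + B y) + (a₀ * - + 1 + A y) * (b₀ * - + 1 + B y))
      ≡⟨ cubeSum-cong n (λ y → cross-terms-cancel a₀ (A y) b₀ (B y)) ⟩
    cubeSum n (λ y → + 2 * (a₀ * b₀) + + 2 * (A y * B y))
      ≡⟨ cubeSum-+ n _ _ ⟩
    cubeSum n (λ _ → + 2 * (a₀ * b₀)) + cubeSum n (λ y → + 2 * (A y * B y))
      ≡⟨ cong₂ _+_ (cubeSum-const n _) (trans (cubeSum-*ˡ n (+ 2) _) (cong (+ 2 *_) (cubeSum-spinSum-* n a′ b′))) ⟩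
    P * (+ 2 * (a₀ * b₀)) + + 2 * (P * ∑[ i < n ] (a′ i * b′ i))
      ≡⟨ collect P (a₀ * b₀) (∑[ i < n ] (a′ i * b′ i)) ⟩
    (P + P) * (a₀ * b₀ + ∑[ i < n ] (a′ i * b′ i))
      ≡⟨ cong (_* (a₀ * b₀ + ∑[ i < n ] (a′ i * b′ i))) (sym (cubeSize-suc n)) ⟩
    cubeSize (suc n) * ∑[ i < suc n ] (a i * b i) ∎
    where
    open ≡-Reasoning
    P = cubeSize n
    a₀ = a zero
    b₀ = b zero
    a′ = λ i → a (suc i)
    b′ = λ i → b (suc i)
    A = spinSum a′
    B = spinSum b′
    cross-terms-cancel : ∀ a A b B → (a * + 1 + A) * (b * + 1 + B) + (a * - + 1 + A) * (b * - + 1 + B) ≡ + 2 * (a * b) + + 2 * (A * B)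
    cross-terms-cancel = solve-∀
    collect : ∀ p x s → p * (+ 2 * x) + + 2 * (p * s) ≡ (p + p) * (x + s)
    collect = solve-∀

  cubeSum-spinSum⁴ : ∀ n (a : Fin n → ℤ) →
    cubeSum n (λ y → square (square (spinSum a y))) ≤ + 3 * cubeSize n * square (∑[ i < n ] square (a i))
  cubeSum-spinSum⁴ zero    a = +≤+ ℕ.z≤n
  cubeSum-spinSum⁴ (suc n) a = begin
    cubeSum n (λ y → square (square (a₀ * + 1 + A y))) + cubeSum n (λ y → square (square (a₀ * - + 1 + A y)))
      ≡⟨ sym (cubeSum-+ n _ _) ⟩
    cubeSum n (λ y → square (square (a₀ * + 1 + A y)) + square (square (a₀ * - + 1 + A y)))
      ≡⟨ cubeSum-cong n (λ y → odd-terms-cancel a₀ (A y)) ⟩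
    cubeSum n (λ y → + 2 * square (square (A y)) + (+ 12 * square a₀) * square (A y) + + 2 * square (square a₀))
      ≡⟨ trans (cubeSum-+ n _ _) (cong₂ _+_ (cubeSum-+ n _ _) (cubeSum-const n _)) ⟩
    cubeSum n (λ y → + 2 * square (square (A y))) + cubeSum n (λ y → (+ 12 * square a₀) * square (A y)) + P * (+ 2 * square (square a₀))
      ≡⟨ cong (_+ P * (+ 2 * square (square a₀))) (cong₂ _+_ (cubeSum-*ˡ n (+ 2) _)
           (trans (cubeSum-*ˡ n (+ 12 * square a₀) (λ y → square (A y))) (cong ((+ 12 * square a₀) *_) (cubeSum-spinSum-* n a′ a′)))) ⟩
    + 2 * cubeSum n (λ y → square (square (A y))) + (+ 12 * square a₀) * (P * W) + P * (+ 2 * square (square a₀))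
      ≤⟨ +-monoˡ-≤ (P * (+ 2 * square (square a₀))) (+-monoˡ-≤ ((+ 12 * square a₀) * (P * W)) (*-monoˡ-≤-nonNeg (+ 2) (cubeSum-spinSum⁴ n a′))) ⟩
    + 2 * (+ 3 * P * square W) + (+ 12 * square a₀) * (P * W) + P * (+ 2 * square (square a₀))
      ≤⟨ ≤-byGap (+ 4 * P * square (square a₀)) (0≤-* (0≤-* (0≤+ 4) (0≤cubeSize n)) (0≤-square (square a₀))) (collect P W a₀) ⟩
    + 3 * (P + P) * square (square a₀ + W)
      ≡⟨ cong (λ p → + 3 * p * square (square a₀ + W)) (sym (cubeSize-suc n)) ⟩
    + 3 * cubeSize (suc n) * square (∑[ i < suc n ] square (a i)) ∎
    where
    open ≤-Reasoning
    P = cubeSize n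
    a₀ = a zero
    a′ = λ i → a (suc i)
    A = spinSum a′
    W = ∑[ i < n ] square (a′ i)
    odd-terms-cancel : ∀ a s → let u = a * + 1 + s; v = a * - + 1 + s in
      (u * u) * (u * u) + (v * v) * (v * v) ≡ + 2 * ((s * s) * (s * s)) + (+ 12 * (a * a)) * (s * s) + + 2 * ((a * a) * (a * a))
    odd-terms-cancel = solve-∀
    collect : ∀ p w a → + 3 * (p + p) * ((a * a + w) * (a * a + w))
                      ≡ (+ 2 * (+ 3 * p * (w * w)) + (+ 12 * (a * a)) * (p * w) + p * (+ 2 * ((a * a) * (a * a))))
                        + + 4 * p * ((a * a) * (a * a))
    collect = solve-∀

  -- Correlation and concentration on the cube

  _≼_ : ∀ {n} → Vec Bool n → Vec Bool n → Set
  _≼_ = Pointwise Bool._≤_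

  Monotone : ∀ n → (Vec Bool n → ℤ) → Set
  Monotone n f = ∀ {y y′ : Vec Bool n} → y ≼ y′ → f y ≤ f y′

  Odd : ∀ n → (Vec Bool n → ℤ) → Set
  Odd n f = ∀ y → f (map not y) ≡ - f y

  spinSum-mono : ∀ {n} (c : Fin n → ℤ) → (∀ i → + 0 ≤ c i) → Monotone n (spinSum c)
  spinSum-mono {n} c 0≤c y≼y′ = ∑-mono n (λ i → *-monoˡ-≤-0≤ (c i) (0≤c i) (spin-mono (Pointwise.lookup y≼y′ i)))

  harris : ∀ n (f g : Vec Bool n → ℤ) → Monotone n f → Monotone n g →
           cubeSum n f * cubeSum n g ≤ cubeSize n * cubeSum n (λ y → f y * g y)
  harris zero    f g _ _ = ≤-reflexive (sym (*-identityˡ (f [] * g [])))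
  harris (suc n) f g f↑ g↑ =
    subst (λ p → (A₁ + A₀) * (B₁ + B₀) ≤ p * (C₁ + C₀)) (sym (cubeSize-suc n))
      (≤-byGap (+ 2 * (P * C₁ - A₁ * B₁) + + 2 * (P * C₀ - A₀ * B₀) + (A₁ - A₀) * (B₁ - B₀))
        (+-mono-≤ (+-mono-≤ (0≤-* (0≤+ 2) (i≤j⇒0≤j-i ih₁)) (0≤-* (0≤+ 2) (i≤j⇒0≤j-i ih₀)))
                  (0≤-* (i≤j⇒0≤j-i A₀≤A₁) (i≤j⇒0≤j-i B₀≤B₁)))
        (expand P A₁ A₀ B₁ B₀ C₁ C₀))
    where
    P = cubeSize n
    f₁ = λ y → f (true ∷ y)
    f₀ = λ y → f (false ∷ y)
    g₁ = λ y → g (true ∷ y)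
    g₀ = λ y → g (false ∷ y)
    A₁ = cubeSum n f₁
    A₀ = cubeSum n f₀
    B₁ = cubeSum n g₁
    B₀ = cubeSum n g₀
    C₁ = cubeSum n (λ y → f₁ y * g₁ y)
    C₀ = cubeSum n (λ y → f₀ y * g₀ y)
    ih₁ = harris n f₁ g₁ (λ le → f↑ (≤ᵇ-refl ∷ le)) (λ le → g↑ (≤ᵇ-refl ∷ le))
    ih₀ = harris n f₀ g₀ (λ le → f↑ (≤ᵇ-refl ∷ le)) (λ le → g↑ (≤ᵇ-refl ∷ le))
    A₀≤A₁ : A₀ ≤ A₁
    A₀≤A₁ = cubeSum-mono n (λ y → f↑ (Bool.f≤t ∷ Pointwise.refl ≤ᵇ-refl))
    B₀≤B₁ : B₀ ≤ B₁
    B₀≤B₁ = cubeSum-mono n (λ y → g↑ (Bool.f≤t ∷ Pointwise.refl ≤ᵇ-refl))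
    expand : ∀ p a₁ a₀ b₁ b₀ c₁ c₀ →
      (p + p) * (c₁ + c₀) ≡ (a₁ + a₀) * (b₁ + b₀) + (+ 2 * (p * c₁ - a₁ * b₁) + + 2 * (p * c₀ - a₀ * b₀) + (a₁ - a₀) * (b₁ - b₀))
    expand = solve-∀

  cubeSum-∘-flip : ∀ n (F : Vec Bool n → ℤ) → cubeSum n (λ y → F (map not y)) ≡ cubeSum n F
  cubeSum-∘-flip zero    F = refl
  cubeSum-∘-flip (suc n) F = trans (cong₂ _+_ (cubeSum-∘-flip n (λ y → F (false ∷ y))) (cubeSum-∘-flip n (λ y → F (true ∷ y))))
                                   (+-comm (cubeSum n (λ y → F (false ∷ y))) _)

  cubeSum-odd : ∀ n f → Odd n f → cubeSum n f ≡ + 0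
  cubeSum-odd n f f-odd = self-neg⇒0 (cubeSum n f)
    (trans (sym (cubeSum-∘-flip n f)) (trans (cubeSum-cong n f-odd) (cubeSum-neg n f)))
    where
    self-neg⇒0 : ∀ x → x ≡ - x → x ≡ + 0
    self-neg⇒0 (+ zero)  _  = refl
    self-neg⇒0 +[1+ m ]  ()
    self-neg⇒0 -[1+ m ]  ()

  harris-odd : ∀ n (f g : Vec Bool n → ℤ) → Monotone n f → Monotone n g → Odd n f →
               + 0 ≤ cubeSum n (λ y → f y * g y)
  harris-odd n f g f↑ g↑ f-odd = *-cancelˡ-≤-pos (+ 0) (cubeSum n (λ y → f y * g y)) (cubeSize n) {{cubeSize-positive n}}
    (subst (_≤ cubeSize n * cubeSum n (λ y → f y * g y)) mean-zero (harris n f g f↑ g↑))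
    where
    mean-zero : cubeSum n f * cubeSum n g ≡ cubeSize n * + 0
    mean-zero = trans (cong (_* cubeSum n g) (cubeSum-odd n f f-odd)) (sym (*-zeroʳ (cubeSize n)))

  variance : ∀ n → (Vec Bool n → ℤ) → ℤ
  variance n f = cubeSize n * cubeSum n (λ y → square (f y)) - square (cubeSum n f)

  variance-zero : ∀ f → variance zero f ≡ + 0
  variance-zero f = trans (cong (_- square (f [])) (*-identityˡ (square (f [])))) (+-inverseʳ (square (f [])))

  variance-suc : ∀ n f → let f₁ = λ y → f (true ∷ y); f₀ = λ y → f (false ∷ y) in
    variance (suc n) f ≡ + 2 * variance n f₁ + + 2 * variance n f₀ + square (cubeSum n f₁ - cubeSum n f₀)
  variance-suc n f =
    trans (cong (λ p → p * (S₁ + S₀) - square (A₁ + A₀)) (cubeSize-suc n)) (law-of-total-variance (cubeSize n) S₁ S₀ A₁ A₀)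
    where
    S₁ = cubeSum n (λ y → square (f (true ∷ y)))
    S₀ = cubeSum n (λ y → square (f (false ∷ y)))
    A₁ = cubeSum n (λ y → f (true ∷ y))
    A₀ = cubeSum n (λ y → f (false ∷ y))
    law-of-total-variance : ∀ p s₁ s₀ a b → (p + p) * (s₁ + s₀) - (a + b) * (a + b) ≡ + 2 * (p * s₁ - a * a) + + 2 * (p * s₀ - b * b) + (a - b) * (a - b)
    law-of-total-variance = solve-∀

  variance-nonNeg : ∀ n f → + 0 ≤ variance n f
  variance-nonNeg zero    f = ≤-reflexive (sym (variance-zero f))
  variance-nonNeg (suc n) f = subst (+ 0 ≤_) (sym (variance-suc n f))
    (+-mono-≤ (+-mono-≤ (0≤-* (0≤+ 2) (variance-nonNeg n _)) (0≤-* (0≤+ 2) (variance-nonNeg n _)))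
              (0≤-square (cubeSum n (λ y → f (true ∷ y)) - cubeSum n (λ y → f (false ∷ y)))))

  efron-stein : ∀ n (f : Vec Bool n → ℤ) K → + 0 ≤ K →
    (∀ i y → square (f y - f (y [ i ]%= not)) ≤ K) →
    + 4 * variance n f ≤ + n * K * (cubeSize n * cubeSize n)
  efron-stein zero    f K _ _ = ≤-reflexive (trans (cong (+ 4 *_) (variance-zero f)) (sym (*-zeroˡ (K * + 1))))
  efron-stein (suc n) f K 0≤K osc = begin
    + 4 * variance (suc n) f
      ≡⟨ cong (+ 4 *_) (variance-suc n f) ⟩
    + 4 * (+ 2 * V₁ + + 2 * V₀ + square (A₁ - A₀))
      ≡⟨ distribute V₁ V₀ (square (A₁ - A₀)) ⟩
    + 2 * (+ 4 * V₁) + + 2 * (+ 4 * V₀) + + 4 * square (A₁ - A₀)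
      ≤⟨ +-mono-≤ (+-mono-≤ (*-monoˡ-≤-nonNeg (+ 2) ih₁) (*-monoˡ-≤-nonNeg (+ 2) ih₀)) (*-monoˡ-≤-nonNeg (+ 4) first-coordinate) ⟩
    + 2 * (+ n * K * (P * P)) + + 2 * (+ n * K * (P * P)) + + 4 * (P * (P * K))
      ≡⟨ collect (+ n) K P ⟩
    (+ 1 + + n) * K * ((P + P) * (P + P))
      ≡⟨ cong₂ (λ u v → u * K * (v * v)) (sym (pos-+ 1 n)) (sym (cubeSize-suc n)) ⟩
    + suc n * K * (cubeSize (suc n) * cubeSize (suc n)) ∎
    where
    open ≤-Reasoning
    P = cubeSize n
    f₁ = λ y → f (true ∷ y)
    f₀ = λ y → f (false ∷ y)
    V₁ = variance n f₁
    V₀ = variance n f₀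
    A₁ = cubeSum n f₁
    A₀ = cubeSum n f₀
    ih₁ = efron-stein n f₁ K 0≤K (λ i y → osc (suc i) (true ∷ y))
    ih₀ = efron-stein n f₀ K 0≤K (λ i y → osc (suc i) (false ∷ y))
    Δf = λ y → f₁ y - f₀ y
    cubeSum-Δf : cubeSum n Δf ≡ A₁ - A₀
    cubeSum-Δf = trans (cubeSum-+ n f₁ (λ y → - f₀ y)) (cong (λ x → A₁ + x) (cubeSum-neg n f₀))
    first-coordinate : square (A₁ - A₀) ≤ P * (P * K)
    first-coordinate = begin
      square (A₁ - A₀)                    ≡⟨ cong square (sym cubeSum-Δf) ⟩
      square (cubeSum n Δf)                ≤⟨ 0≤i-j⇒j≤i (variance-nonNeg n Δf) ⟩
      P * cubeSum n (λ y → square (Δf y))  ≤⟨ *-monoˡ-≤-0≤ P (0≤cubeSize n) (≤-trans (cubeSum-mono n (λ y → osc zero (true ∷ y))) (≤-reflexive (cubeSum-const n K))) ⟩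
      P * (P * K)                         ∎
    distribute : ∀ v₁ v₀ s → + 4 * (+ 2 * v₁ + + 2 * v₀ + s) ≡ + 2 * (+ 4 * v₁) + + 2 * (+ 4 * v₀) + + 4 * s
    distribute = solve-∀
    collect : ∀ m k p → + 2 * (m * k * (p * p)) + + 2 * (m * k * (p * p)) + + 4 * (p * (p * k)) ≡ (+ 1 + m) * k * ((p + p) * (p + p))
    collect = solve-∀

  -- Integrated over the cube against the second and fourth moments, this yields the lower bound on 𝔼|S| below.
  quartic-bound : ∀ a t → + 0 ≤ a → + 0 ≤ t →
    + 4 * square t * square a - square (square a) ≤ + 4 * (t * t * t) * a
  quartic-bound a t 0≤a 0≤t with ≤-total (+ 2 * t) a
  ... | inj₁ 2t≤a = ≤-byGap (a * (+ 4 * (t * t * t) + a * ((a - + 2 * t) * (a + + 2 * t))))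
          (0≤-* 0≤a (+-mono-≤ (0≤-* (0≤+ 4) (0≤-* (0≤-* 0≤t 0≤t) 0≤t))
                              (0≤-* 0≤a (0≤-* (i≤j⇒0≤j-i 2t≤a) (+-mono-≤ 0≤a (0≤-* (0≤+ 2) 0≤t))))))
          (gap a t)
    where
    gap : ∀ a t → + 4 * (t * t * t) * a ≡ (+ 4 * (t * t) * (a * a) - (a * a) * (a * a)) + a * (+ 4 * (t * t * t) + a * ((a - + 2 * t) * (a + + 2 * t)))
    gap = solve-∀
  ... | inj₂ a≤2t = ≤-byGap (a * (square (a - t) * (a + + 2 * t) + t * t * (+ 2 * t - a)))
          (0≤-* 0≤a (+-mono-≤ (0≤-* (0≤-square (a - t)) (+-mono-≤ 0≤a (0≤-* (0≤+ 2) 0≤t)))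
                              (0≤-* (0≤-* 0≤t 0≤t) (i≤j⇒0≤j-i a≤2t))))
          (gap a t)
    where
    gap : ∀ a t → + 4 * (t * t * t) * a ≡ (+ 4 * (t * t) * (a * a) - (a * a) * (a * a)) + a * ((a - t) * (a - t) * (a + + 2 * t) + t * t * (+ 2 * t - a))
    gap = solve-∀

  cubeSum-∣spinSum∣-lower : ∀ n (c : Fin n → ℤ) t → (∀ i → c i * c i ≡ c i) →
    sum c ≤ + suc t * + suc t →
    cubeSize n * sum c ≤ + 4 * + suc t * cubeSum n (λ y → + ∣ spinSum c y ∣)
  cubeSum-∣spinSum∣-lower n c t c-idem k≤T² =
    *-cancelˡ-≤-pos (P * k) (+ 4 * T * E∣S∣) (T * T) (begin
      T * T * (P * k)                              ≤⟨ ≤-byGap (+ 3 * P * k * (T * T - k)) (0≤-* (0≤-* (0≤-* (0≤+ 3) (0≤cubeSize n)) 0≤k) (i≤j⇒0≤j-i k≤T²)) (gap T P k) ⟩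
      + 4 * (T * T) * (P * k) - + 3 * P * (k * k) ≤⟨ +-monoʳ-≤ (+ 4 * (T * T) * (P * k)) (neg-mono-≤ fourth-moment) ⟩
      + 4 * (T * T) * (P * k) - cubeSum n (λ y → square (square (S y))) ≡⟨ sym moments ⟩
      cubeSum n (λ y → + 4 * square T * square (S y) - square (square (S y))) ≤⟨ cubeSum-mono n (λ y → pointwise (S y)) ⟩
      cubeSum n (λ y → + 4 * (T * T * T) * + ∣ S y ∣) ≡⟨ cubeSum-*ˡ n (+ 4 * (T * T * T)) (λ y → + ∣ S y ∣) ⟩
      + 4 * (T * T * T) * E∣S∣ ≡⟨ regroup T E∣S∣ ⟩
      T * T * (+ 4 * T * E∣S∣) ∎)
    where
    open ≤-Reasoning
    T = + suc t
    P = cubeSize n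
    k = sum c
    S = spinSum c
    E∣S∣ = cubeSum n (λ y → + ∣ S y ∣)
    ∑c²≡k : ∑[ i < n ] square (c i) ≡ k
    ∑c²≡k = sum-cong-≗ c-idem
    0≤k : + 0 ≤ k
    0≤k = subst (+ 0 ≤_) ∑c²≡k (∑-nonNeg n (λ i → 0≤-square (c i)))
    fourth-moment : cubeSum n (λ y → square (square (S y))) ≤ + 3 * P * (k * k)
    fourth-moment = subst (λ x → cubeSum n (λ y → square (square (S y))) ≤ + 3 * P * square x) ∑c²≡k (cubeSum-spinSum⁴ n c)
    moments : cubeSum n (λ y → + 4 * square T * square (S y) - square (square (S y))) ≡ + 4 * (T * T) * (P * k) - cubeSum n (λ y → square (square (S y)))
    moments = trans (cubeSum-+ n _ _)
      (cong₂ _+_ (trans (cubeSum-*ˡ n (+ 4 * square T) (λ y → square (S y)))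
                        (cong (+ 4 * square T *_) (trans (cubeSum-spinSum-* n c c) (cong (P *_) ∑c²≡k))))
                 (cubeSum-neg n (λ y → square (square (S y)))))
    pointwise : ∀ s → + 4 * square T * square s - square (square s) ≤ + 4 * (T * T * T) * + ∣ s ∣
    pointwise s = subst (λ x → + 4 * square T * x - x * x ≤ + 4 * (T * T * T) * + ∣ s ∣) (sym (square-∣∣ s))
                        (quartic-bound (+ ∣ s ∣) T (0≤+ _) (0≤+ _))
    gap : ∀ T P k → + 4 * (T * T) * (P * k) - + 3 * P * (k * k) ≡ T * T * (P * k) + + 3 * P * k * (T * T - k)
    gap = solve-∀
    regroup : ∀ T A → + 4 * (T * T * T) * A ≡ T * T * (+ 4 * T * A)
    regroup = solve-∀

  -- Regular graphs and the rounding

  module RegularGraph {n : ℕ} (G : Graph n) (r : ℕ) (regular : Regular G r) where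

    a : Fin n → Fin n → ℤ
    a v w = 𝟙 (adj G v w)

    a-irrefl : ∀ v → a v v ≡ + 0
    a-irrefl v = cong 𝟙 (irrefl G v)

    degree : ∀ v → ∑[ w < n ] a v w ≡ + r
    degree v = trans (sym (+-Σ n (λ w → [ adj G v w ]))) (cong +_ (regular v))

    volume : ∑[ v < n ] ∑[ w < n ] a v w ≡ + r * + n
    volume = trans (sum-cong-≗ degree) (trans (∑-const n (+ r)) (*-comm (+ n) (+ r)))

    edges-regular : + 2 * + edges G ≡ + r * + n
    edges-regular = trans (handshake n (adj G) (Graph.sym G) (irrefl G)) volume

    energy : (Fin n → ℤ) → ℤ
    energy x = ∑[ v < n ] ∑[ w < n ] (a v w * (x v * x w))

    energy-rows : ∀ x → energy x ≡ ∑[ v < n ] (x v * ∑[ w < n ] (a v w * x w))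
    energy-rows x = sum-cong-≗ λ v → trans (sum-cong-≗ λ w → swap (a v w) (x v) (x w))
                                           (sym (*-distribˡ-sum (x v) (λ w → a v w * x w)))
      where
      swap : ∀ a x y → a * (x * y) ≡ x * (a * y)
      swap = solve-∀

    spinEnergy : Vec Bool n → ℤ
    spinEnergy b = energy (λ v → spin (lookup b v))

    cubeSum-spinEnergy : cubeSum n spinEnergy ≡ + 0
    cubeSum-spinEnergy = begin
      cubeSum n spinEnergy
        ≡⟨ cubeSum-cong n (λ y → trans (energy-rows (λ v → spin (lookup y v))) (sum-cong-≗ λ v → cong (_* spinSum (a v) y) (sym (spinSum-δ v y)))) ⟩
      cubeSum n (λ y → ∑[ v < n ] (spinSum (δ v) y * spinSum (a v) y))
        ≡⟨ cubeSum-∑ n n (λ v y → spinSum (δ v) y * spinSum (a v) y) ⟩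
      ∑[ v < n ] cubeSum n (λ y → spinSum (δ v) y * spinSum (a v) y)
        ≡⟨ sum-cong-≗ (λ v → cubeSum-spinSum-* n (δ v) (a v)) ⟩
      ∑[ v < n ] (cubeSize n * ∑[ w < n ] (δ v w * a v w))
        ≡⟨ sum-cong-≗ (λ v → trans (cong (cubeSize n *_) (trans (∑-δ n v (a v)) (a-irrefl v))) (*-zeroʳ (cubeSize n))) ⟩
      ∑[ v < n ] (+ 0)
        ≡⟨ sum-replicate-zero n ⟩
      + 0 ∎
      where open ≡-Reasoning

    cut : Vec Bool n → ℤ
    cut b = ∑[ v < n ] (𝟙 (lookup b v) * ∑[ w < n ] (a v w * 𝟙 (not (lookup b w))))

    cut-spinEnergy : ∀ b → + 2 * (cut b + cut (map not b)) ≡ + r * + n - spinEnergy b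
    cut-spinEnergy b = begin
      + 2 * (cut b + cut (map not b))
        ≡⟨ cong (λ x → + 2 * (cut b + x)) (sum-cong-≗ λ v → cong₂ _*_ (cong 𝟙 (lookup-map v not b))
             (sum-cong-≗ λ w → cong (λ x → a v w * 𝟙 x) (trans (cong not (lookup-map w not b)) (not-involutive _)))) ⟩
      + 2 * (cut b + ∑[ v < n ] (𝟙 (not (b ! v)) * deg₁ v))
        ≡⟨ trans (cong (+ 2 *_) (sym (∑-distrib-+ (λ v → 𝟙 (b ! v) * deg₀ v) (λ v → 𝟙 (not (b ! v)) * deg₁ v))))
                 (*-distribˡ-sum (+ 2) (λ v → 𝟙 (b ! v) * deg₀ v + 𝟙 (not (b ! v)) * deg₁ v)) ⟩
      ∑[ v < n ] (+ 2 * (𝟙 (b ! v) * deg₀ v + 𝟙 (not (b ! v)) * deg₁ v))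
        ≡⟨ sum-cong-≗ row ⟩
      ∑[ v < n ] (+ r - spin (b ! v) * spinSum (a v) b)
        ≡⟨ trans (∑-distrib-+ (λ _ → + r) (λ v → - (spin (b ! v) * spinSum (a v) b)))
                 (cong₂ _+_ (∑-const n (+ r)) (∑-neg n (λ v → spin (b ! v) * spinSum (a v) b))) ⟩
      + n * + r - ∑[ v < n ] (spin (b ! v) * spinSum (a v) b)
        ≡⟨ cong₂ _-_ (*-comm (+ n) (+ r)) (sym (energy-rows (λ v → spin (b ! v)))) ⟩
      + r * + n - spinEnergy b ∎
      where
      open ≡-Reasoning
      _!_ = lookup
      deg₀ deg₁ : Fin n → ℤ
      deg₀ v = ∑[ w < n ] (a v w * 𝟙 (not (b ! w)))
      deg₁ v = ∑[ w < n ] (a v w * 𝟙 (b ! w))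
      edge : ∀ x y α → + 2 * (𝟙 x * (α * 𝟙 (not y)) + 𝟙 (not x) * (α * 𝟙 y)) ≡ α - spin x * (α * spin y)
      edge true  true  = solve-∀
      edge true  false = solve-∀
      edge false true  = solve-∀
      edge false false = solve-∀
      row : ∀ v → + 2 * (𝟙 (b ! v) * deg₀ v + 𝟙 (not (b ! v)) * deg₁ v) ≡ + r - spin (b ! v) * spinSum (a v) b
      row v = begin
        + 2 * (X * deg₀ v + X̄ * deg₁ v)
          ≡⟨ cong (+ 2 *_) (trans (cong₂ _+_ (*-distribˡ-sum X a₀) (*-distribˡ-sum X̄ a₁)) (sym (∑-distrib-+ (λ w → X * a₀ w) (λ w → X̄ * a₁ w)))) ⟩
        + 2 * ∑[ w < n ] (X * a₀ w + X̄ * a₁ w)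
          ≡⟨ *-distribˡ-sum (+ 2) (λ w → X * a₀ w + X̄ * a₁ w) ⟩
        ∑[ w < n ] (+ 2 * (X * a₀ w + X̄ * a₁ w))
          ≡⟨ sum-cong-≗ (λ w → edge (b ! v) (b ! w) (a v w)) ⟩
        ∑[ w < n ] (a v w - spin (b ! v) * (a v w * spin (b ! w)))
          ≡⟨ ∑-distrib-+ (a v) (λ w → - (spin (b ! v) * (a v w * spin (b ! w)))) ⟩
        ∑[ w < n ] a v w + ∑[ w < n ] (- (spin (b ! v) * (a v w * spin (b ! w))))
          ≡⟨ cong₂ _+_ (degree v) (trans (∑-neg n (λ w → spin (b ! v) * (a v w * spin (b ! w))))
                                          (cong -_ (sym (*-distribˡ-sum (spin (b ! v)) (λ w → a v w * spin (b ! w)))))) ⟩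
        + r - spin (b ! v) * spinSum (a v) b ∎
        where
        X = 𝟙 (b ! v)
        X̄ = 𝟙 (not (b ! v))
        a₀ a₁ : Fin n → ℤ
        a₀ w = a v w * 𝟙 (not (b ! w))
        a₁ w = a v w * 𝟙 (b ! w)

    -- spinEnergy has mean zero, so some b has spinEnergy b ≤ 0; then b or its complement cuts half of the edges.
    maxCut : ∃[ b ] (+ r * + n ≤ + 4 * cut b)
    maxCut = uncurry better-of-complements (cubeSum-average n (λ y → - spinEnergy y) (+ 0) mean-zero)
      where
      mean-zero : cubeSize n * + 0 ≤ cubeSum n (λ y → - spinEnergy y)
      mean-zero = ≤-reflexive (trans (*-zeroʳ (cubeSize n)) (sym (trans (cubeSum-neg n spinEnergy) (cong -_ cubeSum-spinEnergy))))
      better-of-complements : ∀ b → + 0 ≤ - spinEnergy b → ∃[ b′ ] (+ r * + n ≤ + 4 * cut b′)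
      better-of-complements b 0≤-E = [ (λ le → b , le) , (λ le → map not b , le) ]′
        (+-≤-split (subst (+ r * + n + + r * + n ≤_) (double (cut b) (cut (map not b))) (+-mono-≤ half half)))
        where
        half : + r * + n ≤ + 2 * (cut b + cut (map not b))
        half = ≤-byGap (- spinEnergy b) 0≤-E (cut-spinEnergy b)
        double : ∀ x y → + 2 * (x + y) + + 2 * (x + y) ≡ + 4 * x + + 4 * y
        double = solve-∀

  signᵇ : ℤ → Bool → Bool
  signᵇ (+ zero)  b = b
  signᵇ +[1+ _ ]  _ = true
  signᵇ -[1+ _ ]  _ = false

  signᵇ-mono : ∀ {u u′ b b′} → u ≤ u′ → b Bool.≤ b′ → signᵇ u b Bool.≤ signᵇ u′ b′
  signᵇ-mono {+ zero}    {+ zero}    _        b≤b′ = b≤b′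
  signᵇ-mono {+ zero}    {+[1+ _ ]}  _        _    = ≤ᵇ-maximum _
  signᵇ-mono {+[1+ _ ]}  {+ zero}    (+≤+ ()) _
  signᵇ-mono {+[1+ _ ]}  {+[1+ _ ]}  _        _    = Bool.b≤b
  signᵇ-mono { -[1+ _ ]} {_}         _        _    = ≤ᵇ-minimum _

  signᵇ-neg : ∀ u b → signᵇ (- u) (not b) ≡ not (signᵇ u b)
  signᵇ-neg (+ zero)  b = refl
  signᵇ-neg +[1+ _ ]  b = refl
  signᵇ-neg -[1+ _ ]  b = refl

  spin-signᵇ : ∀ u b → spin (signᵇ u b) * u ≡ + ∣ u ∣
  spin-signᵇ (+ zero)  b = *-zeroʳ (spin b)
  spin-signᵇ +[1+ m ]  b = *-identityˡ +[1+ m ]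
  spin-signᵇ -[1+ m ]  b = trans (sym (neg-distribˡ-* (+ 1) -[1+ m ])) (cong -_ (*-identityˡ -[1+ m ]))

  if-mono : ∀ β {x x′ u u′} → x Bool.≤ x′ → u Bool.≤ u′ → (if β then x else u) Bool.≤ (if β then x′ else u′)
  if-mono true  x≤x′ _    = x≤x′
  if-mono false _    u≤u′ = u≤u′

  module Rounding {n : ℕ} (G : Graph n) (r : ℕ) (regular : Regular G r) (b₀ : Vec Bool n) where
    open RegularGraph G r regular

    aᴿ aᴸ : Fin n → Fin n → ℤ
    aᴿ v w = a v w * 𝟙 (not (lookup b₀ w))
    aᴸ v w = a v w * 𝟙 (lookup b₀ w)

    𝟙∧𝟙 : ∀ x y → 𝟙 x * 𝟙 y ≡ (if x then 𝟙 y else + 0)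
    𝟙∧𝟙 true  y = *-identityˡ (𝟙 y)
    𝟙∧𝟙 false y = refl

    aᴿ-idem : ∀ v w → aᴿ v w * aᴿ v w ≡ aᴿ v w
    aᴿ-idem v w with adj G v w | not (lookup b₀ w)
    ... | true  | true  = refl
    ... | true  | false = refl
    ... | false | _     = refl

    0≤aᴿ : ∀ v w → + 0 ≤ aᴿ v w
    0≤aᴿ v w = 0≤-* {a v w} {𝟙 (not (lookup b₀ w))} (0≤+ _) (0≤+ _)

    0≤aᴸ : ∀ v w → + 0 ≤ aᴸ v w
    0≤aᴸ v w = 0≤-* {a v w} {𝟙 (lookup b₀ w)} (0≤+ _) (0≤+ _)

    ∑aᴿ≤r : ∀ v → ∑[ w < n ] aᴿ v w ≤ + r
    ∑aᴿ≤r v = ≤-trans (∑-mono n (λ w → aᴿ≤a (adj G v w) (not (lookup b₀ w)))) (≤-reflexive (degree v))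
      where
      aᴿ≤a : ∀ x y → 𝟙 x * 𝟙 y ≤ 𝟙 x
      aᴿ≤a x y = subst (_≤ 𝟙 x) (sym (𝟙∧𝟙 x y)) (lemma x y)
        where
        lemma : ∀ x y → (if x then 𝟙 y else + 0) ≤ 𝟙 x
        lemma true  true  = ≤-refl
        lemma true  false = 0≤+ 1
        lemma false _     = ≤-refl

    aᴿ-absent : ∀ {v w} → adj G v w ≡ false → ∀ x → aᴿ v w * x ≡ + 0
    aᴿ-absent {v} {w} v≁w x = cong (λ e → 𝟙 e * 𝟙 (not (lookup b₀ w)) * x) v≁w

    fieldᴿ : Fin n → Vec Bool n → ℤ
    fieldᴿ v = spinSum (aᴿ v)

    zᵇ : Fin n → Vec Bool n → Bool
    zᵇ v y = if lookup b₀ v then signᵇ (fieldᴿ v y) (lookup y v) else lookup y v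

    z : Fin n → Vec Bool n → ℤ
    z v y = spin (zᵇ v y)

    fieldᴿ-mono : ∀ v → Monotone n (fieldᴿ v)
    fieldᴿ-mono v = spinSum-mono (aᴿ v) (0≤aᴿ v)

    z-mono : ∀ v → Monotone n (z v)
    z-mono v y≼y′ = spin-mono (if-mono (lookup b₀ v) (signᵇ-mono (fieldᴿ-mono v y≼y′) yᵥ≤yᵥ′) yᵥ≤yᵥ′)
      where yᵥ≤yᵥ′ = Pointwise.lookup y≼y′ v

    z-odd : ∀ v → Odd n (z v)
    z-odd v y = begin
      spin (if lookup b₀ v then signᵇ (fieldᴿ v (map not y)) (lookup (map not y) v) else lookup (map not y) v)
        ≡⟨ cong₂ (λ u b → spin (if lookup b₀ v then signᵇ u b else b)) (spinSum-not (aᴿ v) y) (lookup-map v not y) ⟩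
      spin (if lookup b₀ v then signᵇ (- fieldᴿ v y) (not (lookup y v)) else not (lookup y v))
        ≡⟨ cong (λ x → spin (if lookup b₀ v then x else not (lookup y v))) (signᵇ-neg (fieldᴿ v y) (lookup y v)) ⟩
      spin (if lookup b₀ v then not (signᵇ (fieldᴿ v y) (lookup y v)) else not (lookup y v))
        ≡⟨ cong spin (sym (if-float not (lookup b₀ v))) ⟩
      spin (not (zᵇ v y))
        ≡⟨ spin-not (zᵇ v y) ⟩
      - z v y ∎
      where open ≡-Reasoning

    agreement : Vec Bool n → ℤ
    agreement y = energy (λ v → z v y)

    -- Right-side neighbours w have z w y = spin (y w), so their part of the row is z v y times the field.
    agreement-row : ∀ v y → ∑[ w < n ] (a v w * (z v y * z w y))
                          ≡ z v y * fieldᴿ v y + ∑[ w < n ] (aᴸ v w * (z v y * z w y))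
    agreement-row v y = begin
      ∑[ w < n ] (a v w * (z v y * z w y))
        ≡⟨ sum-cong-≗ (λ w → split (adj G v w) (lookup b₀ w) (signᵇ (fieldᴿ w y) (lookup y w)) (lookup y w) (z v y)) ⟩
      ∑[ w < n ] (aᴿ v w * (z v y * spin (lookup y w)) + aᴸ v w * (z v y * z w y))
        ≡⟨ ∑-distrib-+ (λ w → aᴿ v w * (z v y * spin (lookup y w))) (λ w → aᴸ v w * (z v y * z w y)) ⟩
      ∑[ w < n ] (aᴿ v w * (z v y * spin (lookup y w))) + ∑[ w < n ] (aᴸ v w * (z v y * z w y))
        ≡⟨ cong (_+ ∑[ w < n ] (aᴸ v w * (z v y * z w y)))
                (trans (sum-cong-≗ (λ w → swap (aᴿ v w) (z v y) (spin (lookup y w))))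
                       (sym (*-distribˡ-sum (z v y) (λ w → aᴿ v w * spin (lookup y w))))) ⟩
      z v y * fieldᴿ v y + ∑[ w < n ] (aᴸ v w * (z v y * z w y)) ∎
      where
      open ≡-Reasoning
      swap : ∀ a x y → a * (x * y) ≡ x * (a * y)
      swap = solve-∀
      split : ∀ A B X y x → 𝟙 A * (x * spin (if B then X else y))
                            ≡ (𝟙 A * 𝟙 (not B)) * (x * spin y) + (𝟙 A * 𝟙 B) * (x * spin (if B then X else y))
      split false B     X y x = refl
      split true  true  X y x = right-empty x (spin y) (spin X)
        where
        right-empty : ∀ x s t → + 1 * (x * t) ≡ (+ 1 * + 0) * (x * s) + (+ 1 * + 1) * (x * t)
        right-empty = solve-∀
      split true  false X y x = left-empty x (spin y)
        where
        left-empty : ∀ x s → + 1 * (x * s) ≡ (+ 1 * + 1) * (x * s) + (+ 1 * + 0) * (x * s)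
        left-empty = solve-∀

    ∑-cubeSum-z*fieldᴿ≤cubeSum-agreement :
      ∑[ v < n ] cubeSum n (λ y → z v y * fieldᴿ v y) ≤ cubeSum n agreement
    ∑-cubeSum-z*fieldᴿ≤cubeSum-agreement = begin
      ∑[ v < n ] cubeSum n (λ y → z v y * fieldᴿ v y)
        ≤⟨ ∑-mono n (λ v → ≤-byGap (∑[ w < n ] cubeSum n (λ y → aᴸ v w * (z v y * z w y)))
                                   (∑-nonNeg n (λ w → 0≤-aᴸ-correlation v w)) refl) ⟩
      ∑[ v < n ] (cubeSum n (λ y → z v y * fieldᴿ v y) + ∑[ w < n ] cubeSum n (λ y → aᴸ v w * (z v y * z w y)))
        ≡⟨ sum-cong-≗ (λ v → trans (cong (λ x → cubeSum n (λ y → z v y * fieldᴿ v y) + x)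
                                        (sym (cubeSum-∑ n n (λ w y → aᴸ v w * (z v y * z w y)))))
                                  (sym (cubeSum-+ n (λ y → z v y * fieldᴿ v y) (λ y → ∑[ w < n ] (aᴸ v w * (z v y * z w y)))))) ⟩
      ∑[ v < n ] cubeSum n (λ y → z v y * fieldᴿ v y + ∑[ w < n ] (aᴸ v w * (z v y * z w y)))
        ≡⟨ sum-cong-≗ (λ v → cubeSum-cong n (λ y → sym (agreement-row v y))) ⟩
      ∑[ v < n ] cubeSum n (λ y → ∑[ w < n ] (a v w * (z v y * z w y)))
        ≡⟨ sym (cubeSum-∑ n n (λ v y → ∑[ w < n ] (a v w * (z v y * z w y)))) ⟩
      cubeSum n agreement ∎
      where
      open ≤-Reasoning
      0≤-aᴸ-correlation : ∀ v w → + 0 ≤ cubeSum n (λ y → aᴸ v w * (z v y * z w y))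
      0≤-aᴸ-correlation v w = subst (+ 0 ≤_) (sym (cubeSum-*ˡ n (aᴸ v w) (λ y → z v y * z w y)))
        (0≤-* {aᴸ v w} (0≤aᴸ v w) (harris-odd n (z v) (z w) (z-mono v) (z-mono w) (z-odd v)))

    gain-vertex : (t : ℕ) → + r ≤ + suc t * + suc t → ∀ v →
      cubeSize n * (𝟙 (lookup b₀ v) * ∑[ w < n ] aᴿ v w) ≤ + 4 * + suc t * cubeSum n (λ y → z v y * fieldᴿ v y)
    gain-vertex t r≤T² v = by-side (lookup b₀ v) refl
      where
      T = + suc t
      by-side : ∀ β → lookup b₀ v ≡ β → cubeSize n * (𝟙 β * ∑[ w < n ] aᴿ v w) ≤ + 4 * T * cubeSum n (λ y → z v y * fieldᴿ v y)
      by-side true b₀ᵥ = begin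
        cubeSize n * (+ 1 * ∑[ w < n ] aᴿ v w)                ≡⟨ cong (cubeSize n *_) (*-identityˡ _) ⟩
        cubeSize n * ∑[ w < n ] aᴿ v w                        ≤⟨ cubeSum-∣spinSum∣-lower n (aᴿ v) t (aᴿ-idem v) (≤-trans (∑aᴿ≤r v) r≤T²) ⟩
        + 4 * T * cubeSum n (λ y → + ∣ fieldᴿ v y ∣)          ≡⟨ cong (+ 4 * T *_) (cubeSum-cong n aligned) ⟩
        + 4 * T * cubeSum n (λ y → z v y * fieldᴿ v y)        ∎
        where
        open ≤-Reasoning
        aligned : ∀ y → + ∣ fieldᴿ v y ∣ ≡ z v y * fieldᴿ v y
        aligned y = sym (trans (cong (λ β → spin (if β then signᵇ (fieldᴿ v y) (lookup y v) else lookup y v) * fieldᴿ v y) b₀ᵥ)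
                               (spin-signᵇ (fieldᴿ v y) (lookup y v)))
      by-side false _ = subst (_≤ + 4 * T * cubeSum n (λ y → z v y * fieldᴿ v y)) (sym (*-zeroʳ (cubeSize n)))
                              (0≤-* {+ 4 * T} (0≤+ _) (harris-odd n (z v) (fieldᴿ v) (z-mono v) (fieldᴿ-mono v) (z-odd v)))

    gain : (t : ℕ) → + r ≤ + suc t * + suc t → cubeSize n * cut b₀ ≤ + 4 * + suc t * cubeSum n agreement
    gain t r≤T² = begin
      cubeSize n * cut b₀
        ≡⟨ *-distribˡ-sum (cubeSize n) (λ v → 𝟙 (lookup b₀ v) * ∑[ w < n ] aᴿ v w) ⟩
      ∑[ v < n ] (cubeSize n * (𝟙 (lookup b₀ v) * ∑[ w < n ] aᴿ v w))
        ≤⟨ ∑-mono n (gain-vertex t r≤T²) ⟩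
      ∑[ v < n ] (+ 4 * T * cubeSum n (λ y → z v y * fieldᴿ v y))
        ≡⟨ sym (*-distribˡ-sum (+ 4 * T) (λ v → cubeSum n (λ y → z v y * fieldᴿ v y))) ⟩
      + 4 * T * ∑[ v < n ] cubeSum n (λ y → z v y * fieldᴿ v y)
        ≤⟨ *-monoˡ-≤-0≤ (+ 4 * T) (0≤+ _) ∑-cubeSum-z*fieldᴿ≤cubeSum-agreement ⟩
      + 4 * T * cubeSum n agreement ∎
      where
      open ≤-Reasoning
      T = + suc t

    imbalance : Vec Bool n → ℤ
    imbalance y = ∑[ v < n ] z v y

    imbalance-odd : Odd n imbalance
    imbalance-odd y = trans (sum-cong-≗ (λ v → z-odd v y)) (∑-neg n (λ v → z v y))

    z-flip-far : ∀ v i y → i ≢ v → adj G v i ≡ false → z v (y [ i ]%= not) ≡ z v y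
    z-flip-far v i y i≢v v≁i = cong₂ (λ u b → spin (if lookup b₀ v then signᵇ u b else b)) field-same yᵥ-same
      where
      yᵥ-same : lookup (y [ i ]%= not) v ≡ lookup y v
      yᵥ-same = lookup∘updateAt′ v i (λ v≡i → i≢v (sym v≡i)) y
      field-same : fieldᴿ v (y [ i ]%= not) ≡ fieldᴿ v y
      field-same = sum-cong-≗ term
        where
        term : ∀ w → aᴿ v w * spin (lookup (y [ i ]%= not) w) ≡ aᴿ v w * spin (lookup y w)
        term w with w ≟ i
        ... | yes refl = trans (aᴿ-absent v≁i _) (sym (aᴿ-absent v≁i _))
        ... | no w≢i  = cong (λ b → aᴿ v w * spin b) (lookup∘updateAt′ w i w≢i y)

    ∣Δz∣ : ∀ i y v → + ∣ z v y - z v (y [ i ]%= not) ∣ ≤ + 2 * (δ i v + a i v)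
    ∣Δz∣ i y v with i ≟ v
    ... | yes refl = ≤-trans (∣spin-spin∣≤2 (zᵇ i y) (zᵇ i (y [ i ]%= not)))
                             (≤-reflexive (sym (cong₂ (λ d x → + 2 * (d + x)) (δ-diag i) (a-irrefl i))))
    ... | no i≢v with adj G v i in v~i
    ...   | true  = ≤-trans (∣spin-spin∣≤2 (zᵇ v y) (zᵇ v (y [ i ]%= not)))
                            (≤-reflexive (sym (cong₂ (λ d x → + 2 * (d + 𝟙 x)) (δ-≢ i≢v) (trans (Graph.sym G i v) v~i))))
    ...   | false = subst (λ x → + ∣ x ∣ ≤ + 2 * (δ i v + a i v))
                          (sym (trans (cong (λ x → z v y - x) (z-flip-far v i y i≢v v~i)) (+-inverseʳ (z v y))))
                          (0≤-* {+ 2} (0≤+ 2) (subst (+ 0 ≤_) (sym (cong (_+ a i v) (δ-≢ i≢v))) (0≤+ _)))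

    jump² : ℤ
    jump² = square (+ 2 * (+ 1 + + r))

    imbalance-oscillation : ∀ i y → square (imbalance y - imbalance (y [ i ]%= not)) ≤ jump²
    imbalance-oscillation i y = square-mono-∣∣ (imbalance y - imbalance y′) (+ 2 * (+ 1 + + r)) (begin
      + ∣ imbalance y - imbalance y′ ∣                 ≡⟨ cong (λ x → + ∣ x ∣) (sym Δimbalance) ⟩
      + ∣ ∑[ v < n ] (z v y - z v y′) ∣                ≤⟨ ∣∑∣≤∑∣∣ n (λ v → z v y - z v y′) ⟩
      ∑[ v < n ] (+ ∣ z v y - z v y′ ∣)                ≤⟨ ∑-mono n (∣Δz∣ i y) ⟩
      ∑[ v < n ] (+ 2 * (δ i v + a i v))               ≡⟨ sym (*-distribˡ-sum (+ 2) (λ v → δ i v + a i v)) ⟩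
      + 2 * ∑[ v < n ] (δ i v + a i v)                 ≡⟨ cong (+ 2 *_) (trans (∑-distrib-+ (δ i) (a i)) (cong₂ _+_ (∑-δ-const n i) (degree i))) ⟩
      + 2 * (+ 1 + + r)                                ∎)
      where
      open ≤-Reasoning
      y′ = y [ i ]%= not
      Δimbalance : ∑[ v < n ] (z v y - z v y′) ≡ imbalance y - imbalance y′
      Δimbalance = trans (∑-distrib-+ (λ v → z v y) (λ v → - z v y′)) (cong (λ x → imbalance y + x) (∑-neg n (λ v → z v y′)))

    cubeSum-imbalance² : + 4 * cubeSum n (λ y → square (imbalance y)) ≤ + n * jump² * cubeSize n
    cubeSum-imbalance² = *-cancelˡ-≤-pos _ (+ n * jump² * P) P {{cubeSize-positive n}} (begin
      P * (+ 4 * cubeSum n (λ y → square (imbalance y)))  ≡⟨ centred P (cubeSum n (λ y → square (imbalance y))) (cubeSum n imbalance) (cubeSum-odd n imbalance imbalance-odd) ⟩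
      + 4 * variance n imbalance                          ≤⟨ efron-stein n imbalance jump² (0≤-square (+ 2 * (+ 1 + + r))) imbalance-oscillation ⟩
      + n * jump² * (P * P)                                   ≡⟨ regroup (+ n) jump² P ⟩
      P * (+ n * jump² * P)                                   ∎)
      where
      open ≤-Reasoning
      P = cubeSize n
      centred : ∀ p x m → m ≡ + 0 → p * (+ 4 * x) ≡ + 4 * (p * x - m * m)
      centred p x m refl = lemma p x
        where
        lemma : ∀ p x → p * (+ 4 * x) ≡ + 4 * (p * x - + 0 * + 0)
        lemma = solve-∀
      regroup : ∀ m k p → m * k * (p * p) ≡ p * (m * k * p)
      regroup = solve-∀

    -- Φ y = 2 r n² q(y), where q(y) is the modularity of the partition by the signs z v y.
    Φ : Vec Bool n → ℤ
    Φ y = + n * agreement y - + r * square (imbalance y)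

    good-rounding : (t : ℕ) → + r ≤ + suc t * + suc t → + 8 * + suc t * jump² ≤ + n → + r * + n ≤ + 4 * cut b₀ →
                    ∃[ y ] (+ n * + n * + r ≤ + 32 * + suc t * Φ y)
    good-rounding t r≤T² n-large cut-large = cubeSum-average n (λ y → + 32 * T * Φ y) (+ n * + n * + r) (begin
      P * (+ n * + n * + r)
        ≤⟨ ≤-byGap gap 0≤gap (expand (+ n) (+ r) T P A S² C jump²) ⟩
      + 32 * T * (+ n * A - + r * S²)
        ≡⟨ sym cubeSum-Φ ⟩
      cubeSum n (λ y → + 32 * T * Φ y) ∎)
      where
      open ≤-Reasoning
      T = + suc t
      P = cubeSize n
      A = cubeSum n agreement
      S² = cubeSum n (λ y → square (imbalance y))
      C = cut b₀
      gap = + 8 * + n * (+ 4 * T * A - P * C) + + 2 * + n * P * (+ 4 * C - + r * + n) + + r * + n * P * (+ n - + 8 * T * jump²) + + 8 * T * + r * (+ n * jump² * P - + 4 * S²)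
      0≤gap : + 0 ≤ gap
      0≤gap = +-mono-≤ (+-mono-≤ (+-mono-≤
        (0≤-* (0≤-* (0≤+ 8) (0≤+ n)) (i≤j⇒0≤j-i (gain t r≤T²)))
        (0≤-* (0≤-* (0≤-* (0≤+ 2) (0≤+ n)) (0≤cubeSize n)) (i≤j⇒0≤j-i cut-large)))
        (0≤-* (0≤-* (0≤-* (0≤+ r) (0≤+ n)) (0≤cubeSize n)) (i≤j⇒0≤j-i n-large)))
        (0≤-* (0≤-* (0≤-* (0≤+ 8) (0≤+ (suc t))) (0≤+ r)) (i≤j⇒0≤j-i cubeSum-imbalance²))
      cubeSum-Φ : cubeSum n (λ y → + 32 * T * Φ y) ≡ + 32 * T * (+ n * A - + r * S²)
      cubeSum-Φ = trans (cubeSum-*ˡ n (+ 32 * T) Φ) (cong (+ 32 * T *_)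
        (trans (cubeSum-+ n (λ y → + n * agreement y) (λ y → - (+ r * square (imbalance y))))
               (cong₂ _+_ (cubeSum-*ˡ n (+ n) agreement)
                          (trans (cubeSum-neg n (λ y → + r * square (imbalance y))) (cong -_ (cubeSum-*ˡ n (+ r) (λ y → square (imbalance y))))))))
      expand : ∀ n r T P A S² C J → + 32 * T * (n * A - r * S²)
        ≡ P * (n * n * r) + (+ 8 * n * (+ 4 * T * A - P * C) + + 2 * n * P * (+ 4 * C - r * n)
                             + r * n * P * (n - + 8 * T * J) + + 8 * T * r * (n * J * P - + 4 * S²))
      expand = solve-∀

  module TwoParts {n′ : ℕ} (G : Graph (suc (suc n′))) (r : ℕ) (regular : Regular G r) (β : Fin (suc (suc n′)) → Bool) where
    open RegularGraph G r regular

    N : ℕ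
    N = suc (suc n′)

    label : Bool → Fin N
    label true  = zero
    label false = suc zero

    parts : Partition N
    parts i = label (β i)

    together : Fin N → Fin N → Bool
    together i j = adj G i j ∧ ⌊ parts i ≟ parts j ⌋

    together-sym : ∀ i j → together i j ≡ together j i
    together-sym i j = cong₂ _∧_ (Graph.sym G i j) (≟-sym (parts i) (parts j))
      where
      ≟-sym : (x y : Fin N) → ⌊ x ≟ y ⌋ ≡ ⌊ y ≟ x ⌋
      ≟-sym x y with x ≟ y | y ≟ x
      ... | yes _   | yes _   = refl
      ... | yes x≡y | no y≢x  = ⊥-elim (y≢x (sym x≡y))
      ... | no x≢y  | yes y≡x = ⊥-elim (x≢y (sym y≡x))
      ... | no _    | no _    = refl

    together-irrefl : ∀ i → together i i ≡ false
    together-irrefl i = cong (_∧ ⌊ parts i ≟ parts i ⌋) (irrefl G i)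

    eIn-parts : + 4 * + eIn G parts ≡ + r * + N + energy (λ v → spin (β v))
    eIn-parts = begin
      + 4 * + eIn G parts
        ≡⟨ twice-twice (+ eIn G parts) ⟩
      + 2 * (+ 2 * + eIn G parts)
        ≡⟨ cong (+ 2 *_) (handshake N together together-sym together-irrefl) ⟩
      + 2 * ∑[ i < N ] ∑[ j < N ] 𝟙 (together i j)
        ≡⟨ trans (*-distribˡ-sum (+ 2) (λ i → ∑[ j < N ] 𝟙 (together i j))) (sum-cong-≗ (λ i → *-distribˡ-sum (+ 2) (λ j → 𝟙 (together i j)))) ⟩
      ∑[ i < N ] ∑[ j < N ] (+ 2 * 𝟙 (together i j))
        ≡⟨ sum-cong-≗ (λ i → sum-cong-≗ (λ j → pair (adj G i j) (β i) (β j))) ⟩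
      ∑[ i < N ] ∑[ j < N ] (a i j + a i j * (spin (β i) * spin (β j)))
        ≡⟨ trans (sum-cong-≗ (λ i → ∑-distrib-+ (a i) (λ j → a i j * (spin (β i) * spin (β j)))))
                 (∑-distrib-+ (λ i → ∑[ j < N ] a i j) (λ i → ∑[ j < N ] (a i j * (spin (β i) * spin (β j))))) ⟩
      ∑[ i < N ] ∑[ j < N ] a i j + energy (λ v → spin (β v))
        ≡⟨ cong (_+ energy (λ v → spin (β v))) volume ⟩
      + r * + N + energy (λ v → spin (β v)) ∎
      where
      open ≡-Reasoning
      twice-twice : ∀ x → + 4 * x ≡ + 2 * (+ 2 * x)
      twice-twice = solve-∀
      pair : ∀ e x y → + 2 * 𝟙 (e ∧ ⌊ label x ≟ label y ⌋) ≡ 𝟙 e + 𝟙 e * (spin x * spin y)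
      pair false _     _     = refl
      pair true  true  true  = refl
      pair true  true  false = refl
      pair true  false true  = refl
      pair true  false false = refl

    size : Fin N → ℤ
    size k = ∑[ i < N ] 𝟙 ⌊ parts i ≟ k ⌋

    vol-parts : ∀ k → + vol G parts k ≡ + r * size k
    vol-parts k = trans (+-Σ N (λ i → if ⌊ parts i ≟ k ⌋ then deg G i else 0))
                        (trans (sum-cong-≗ (λ i → regular-term ⌊ parts i ≟ k ⌋ i)) (sym (*-distribˡ-sum (+ r) (λ i → 𝟙 ⌊ parts i ≟ k ⌋))))
      where
      regular-term : ∀ b i → + (if b then deg G i else 0) ≡ + r * 𝟙 b
      regular-term true  i = trans (cong +_ (regular i)) (sym (*-identityʳ (+ r)))
      regular-term false i = sym (*-zeroʳ (+ r))

    nᵗ nᶠ : ℤ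
    nᵗ = ∑[ i < N ] 𝟙 (β i)
    nᶠ = ∑[ i < N ] 𝟙 (not (β i))

    sumVolSq-parts : + 2 * + sumVolSq G parts ≡ + r * + r * (+ N * + N + square (∑[ v < N ] spin (β v)))
    sumVolSq-parts = begin
      + 2 * + sumVolSq G parts
        ≡⟨ cong (+ 2 *_) (trans (+-Σ N (λ k → vol G parts k ℕ.* vol G parts k)) (sum-cong-≗ volSq)) ⟩
      + 2 * ∑[ k < N ] square (+ r * size k)
        ≡⟨ cong (+ 2 *_) (cong₂ _+_ (cong (λ u → square (+ r * u)) size-true)
             (cong₂ _+_ (cong (λ u → square (+ r * u)) size-false) empty-labels)) ⟩
      + 2 * (square (+ r * nᵗ) + (square (+ r * nᶠ) + + 0))
        ≡⟨ parallelogram (+ r) nᵗ nᶠ ⟩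
      + r * + r * (square (nᵗ + nᶠ) + square (nᵗ - nᶠ))
        ≡⟨ cong₂ (λ u v → + r * + r * (square u + square v)) (sym N≡nᵗ+nᶠ) (sym ∑spin≡nᵗ-nᶠ) ⟩
      + r * + r * (+ N * + N + square (∑[ v < N ] spin (β v))) ∎
      where
      open ≡-Reasoning
      volSq : ∀ k → + (vol G parts k ℕ.* vol G parts k) ≡ square (+ r * size k)
      volSq k = trans (pos-* (vol G parts k) (vol G parts k)) (cong square (vol-parts k))
      size-true : size zero ≡ nᵗ
      size-true = sum-cong-≗ (λ i → is-true (β i))
        where
        is-true : ∀ x → 𝟙 ⌊ label x ≟ zero ⌋ ≡ 𝟙 x
        is-true true  = refl
        is-true false = refl
      size-false : size (suc zero) ≡ nᶠ
      size-false = sum-cong-≗ (λ i → is-false (β i))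
        where
        is-false : ∀ x → 𝟙 ⌊ label x ≟ suc zero ⌋ ≡ 𝟙 (not x)
        is-false true  = refl
        is-false false = refl
      empty-labels : ∑[ k < n′ ] square (+ r * size (suc (suc k))) ≡ + 0
      empty-labels = trans (sum-cong-≗ (λ k → trans (cong (λ u → square (+ r * u)) (trans (sum-cong-≗ (λ i → unused (β i) k)) (sum-replicate-zero N)))
                                                 (cong square (*-zeroʳ (+ r)))))
                           (sum-replicate-zero n′)
        where
        unused : ∀ x k → 𝟙 ⌊ label x ≟ suc (suc k) ⌋ ≡ + 0
        unused true  k = refl
        unused false k = refl
      N≡nᵗ+nᶠ : + N ≡ nᵗ + nᶠ
      N≡nᵗ+nᶠ = sym (trans (sym (∑-distrib-+ (λ i → 𝟙 (β i)) (λ i → 𝟙 (not (β i)))))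
                           (trans (sum-cong-≗ (λ i → one (β i))) (trans (∑-const N (+ 1)) (*-identityʳ (+ N)))))
        where
        one : ∀ x → 𝟙 x + 𝟙 (not x) ≡ + 1
        one true  = refl
        one false = refl
      ∑spin≡nᵗ-nᶠ : ∑[ v < N ] spin (β v) ≡ nᵗ - nᶠ
      ∑spin≡nᵗ-nᶠ = sym (trans (cong (λ x → nᵗ + x) (sym (∑-neg N (λ i → 𝟙 (not (β i))))))
                               (trans (sym (∑-distrib-+ (λ i → 𝟙 (β i)) (λ i → - 𝟙 (not (β i))))) (sum-cong-≗ (λ i → diff (β i)))))
        where
        diff : ∀ x → 𝟙 x - 𝟙 (not x) ≡ spin x
        diff true  = refl
        diff false = refl
      parallelogram : ∀ r a b → + 2 * ((r * a) * (r * a) + ((r * b) * (r * b) + + 0)) ≡ r * r * ((a + b) * (a + b) + (a - b) * (a - b))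
      parallelogram = solve-∀

  -- Modularity of the rounded partition

  c₀ : ℚ
  c₀ = + 1 ℚ./ 128

  0<c₀ : 0ℚ ℚ.< c₀
  0<c₀ = ℚ.*<* (+<+ (ℕ.s≤s ℕ.z≤n))

  -- c₀² = 1 / 16384.
  /√≤-fraction : ∀ r x p d → toℚᵘ x ℚᵘ.≃ mkℚᵘ p d → + 0 ≤ p →
    square (+ suc d) ≤ + 16384 * (square p * + r) → c₀ /√ r ≤ x
  /√≤-fraction r x p d x≃ 0≤p bound = nonNeg , squared
    where
    nonNeg : 0ℚ ℚ.≤ x
    nonNeg = ℚ.toℚᵘ-cancel-≤ (ℚᵘ.≤-respʳ-≃ (ℚᵘ.≃-sym x≃) (*≤* (subst (+ 0 ≤_) (sym (*-identityʳ p)) 0≤p)))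
    toℚᵘ-rhs : toℚᵘ ((x ℚ.* x) ℚ.* toℚ r) ℚᵘ.≃ (mkℚᵘ p d ℚᵘ.* mkℚᵘ p d) ℚᵘ.* mkℚᵘ (+ r) 0
    toℚᵘ-rhs = ℚᵘ.≃-trans (ℚ.toℚᵘ-homo-* (x ℚ.* x) (toℚ r))
                 (ℚᵘ.*-cong (ℚᵘ.≃-trans (ℚ.toℚᵘ-homo-* x x) (ℚᵘ.*-cong x≃ x≃)) (ℚ.toℚᵘ-fromℚᵘ (mkℚᵘ (+ r) 0)))
    squared-denominator : + 1 * + (suc d ℕ.* suc d ℕ.* 1) ≡ square (+ suc d)
    squared-denominator = trans (*-identityˡ _) (trans (cong +_ (ℕ.*-identityʳ _)) (sym (pos-* (suc d) (suc d))))
    squared : c₀ ℚ.* c₀ ℚ.≤ (x ℚ.* x) ℚ.* toℚ r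
    squared = ℚ.toℚᵘ-cancel-≤ (ℚᵘ.≤-respʳ-≃ (ℚᵘ.≃-sym toℚᵘ-rhs) (*≤* (subst₂ _≤_ (sym squared-denominator) (*-comm (+ 16384) (square p * + r)) bound)))

  toℚᵘ-inv*toℚ : ∀ k n → toℚᵘ (inv (suc k) ℚ.* toℚ n) ℚᵘ.≃ mkℚᵘ (+ n) k
  toℚᵘ-inv*toℚ k n = ℚᵘ.≃-trans (ℚ.toℚᵘ-homo-* (inv (suc k)) (toℚ n))
    (ℚᵘ.≃-trans (ℚᵘ.*-cong (ℚ.toℚᵘ-fromℚᵘ (mkℚᵘ (+ 1) k)) (ℚ.toℚᵘ-fromℚᵘ (mkℚᵘ (+ n) 0)))
                (*≡* (cong₂ _*_ (*-identityˡ (+ n)) (cong +_ (sym (ℕ.*-identityʳ (suc k)))))))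

  toℚᵘ-difference : ∀ k k′ E V → toℚᵘ (inv (suc k) ℚ.* toℚ E ℚ.- inv (suc k′) ℚ.* toℚ V)
                                  ℚᵘ.≃ mkℚᵘ (+ E * + suc k′ + - + V * + suc k) (k′ ℕ.+ k ℕ.* suc k′)
  toℚᵘ-difference k k′ E V = ℚᵘ.≃-trans (ℚ.toℚᵘ-homo-+ (inv (suc k) ℚ.* toℚ E) (ℚ.- (inv (suc k′) ℚ.* toℚ V)))
    (ℚᵘ.+-cong (toℚᵘ-inv*toℚ k E) (ℚᵘ.≃-trans (ℚ.toℚᵘ-homo‿- (inv (suc k′) ℚ.* toℚ V)) (ℚᵘ.-‿cong (toℚᵘ-inv*toℚ k′ V))))

  -- With q = W / 4m², the hypothesis reads q ≥ 1 / 16T, and T² ≤ 4r turns this into q² r ≥ 1/16384.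
  fraction-bound : ∀ k t W r → let m = + suc k; T = + suc t in
    + 4 * m * m ≤ + 64 * T * W → T * T ≤ + 4 * r →
    + 0 ≤ m * W × square (m * (+ 4 * m * m)) ≤ + 16384 * (square (m * W) * r)
  -- Implicit arguments are supplied where inferring them would make Agda unfold products with literals.
  fraction-bound k t W r 4m²≤64TW T²≤4r = 0≤-* (0≤+ (suc k)) 0≤W , (begin
    square (m * (+ 4 * m * m))                       ≡⟨ expand m ⟩
    + 16 * square m * square (square m)              ≤⟨ *-monoˡ-≤-0≤ (+ 16 * square m) {square (square m)} {square (+ 16 * T * W)} 0≤16m²
                                                          (square-mono-0≤ (0≤-square m) m²≤16TW) ⟩
    + 16 * square m * square (+ 16 * T * W)          ≡⟨ cong (+ 16 * square m *_) {square (+ 16 * T * W)} {+ 256 * (T * T) * square W} (square-16TW T W) ⟩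
    + 16 * square m * (+ 256 * (T * T) * square W)   ≤⟨ *-monoˡ-≤-0≤ (+ 16 * square m) {+ 256 * (T * T) * square W} {+ 256 * (+ 4 * r) * square W} 0≤16m²
                                                          (*-monoʳ-≤-nonNeg (square W) {{ℤ.nonNegative (0≤-square W)}} (*-monoˡ-≤-nonNeg (+ 256) T²≤4r)) ⟩
    + 16 * square m * (+ 256 * (+ 4 * r) * square W) ≡⟨ collect m W r ⟩
    + 16384 * (square (m * W) * r)                   ∎)
    where
    open ≤-Reasoning
    m = + suc k
    T = + suc t
    0≤16m² : + 0 ≤ + 16 * square m
    0≤16m² = 0≤-* (0≤+ 16) (0≤-square m)
    0≤W : + 0 ≤ W
    0≤W = *-cancelˡ-≤-pos (+ 0) W (+ 64 * T) (≤-trans (≤-reflexive (*-zeroʳ (+ 64 * T))) (≤-trans (0≤-* (0≤-* (0≤+ 4) (0≤+ (suc k))) (0≤+ (suc k))) 4m²≤64TW))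
    m²≤16TW : square m ≤ + 16 * T * W
    m²≤16TW = *-cancelˡ-≤-pos (square m) (+ 16 * T * W) (+ 4) (subst₂ _≤_ (regroup₁ m) (regroup₂ T W) 4m²≤64TW)
      where
      regroup₁ : ∀ m → + 4 * m * m ≡ + 4 * (m * m)
      regroup₁ = solve-∀
      regroup₂ : ∀ T W → + 64 * T * W ≡ + 4 * (+ 16 * T * W)
      regroup₂ = solve-∀
    expand : ∀ m → (m * (+ 4 * m * m)) * (m * (+ 4 * m * m)) ≡ + 16 * (m * m) * ((m * m) * (m * m))
    expand = solve-∀
    square-16TW : ∀ T W → (+ 16 * T * W) * (+ 16 * T * W) ≡ + 256 * (T * T) * (W * W)
    square-16TW = solve-∀
    collect : ∀ m W r → + 16 * (m * m) * (+ 256 * (+ 4 * r) * (W * W)) ≡ + 16384 * ((m * W) * (m * W) * r)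
    collect m W r = constants (+ 16) (+ 256) (+ 4) m W r
      where
      constants : ∀ a b c m W r → a * (m * m) * (b * (c * r) * (W * W)) ≡ (a * b * c) * ((m * W) * (m * W) * r)
      constants = solve-∀

  modularity-lower-bound-suc : ∀ k k′ E V t r → suc k′ ≡ 4 ℕ.* suc k ℕ.* suc k →
    + suc k′ ≤ + 64 * + suc t * (+ 4 * + suc k * + E - + V) → + suc t * + suc t ≤ + 4 * + r →
    c₀ /√ r ≤ (inv (suc k) ℚ.* toℚ E ℚ.- inv (suc k′) ℚ.* toℚ V)
  modularity-lower-bound-suc k k′ E V t r k′≡ 4m²≤64TW T²≤4r =
    /√≤-fraction r (inv (suc k) ℚ.* toℚ E ℚ.- inv (suc k′) ℚ.* toℚ V) (+ E * + suc k′ + - + V * m) (k′ ℕ.+ k ℕ.* suc k′)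
      (toℚᵘ-difference k k′ E V)
      (subst (+ 0 ≤_) (sym numerator) (proj₁ core))
      bound
    where
    m = + suc k
    W = + 4 * m * + E - + V
    4m² : + suc k′ ≡ + 4 * m * m
    4m² = trans (cong +_ k′≡) (trans (pos-* (4 ℕ.* suc k) (suc k)) (cong (_* m) (pos-* 4 (suc k))))
    core : + 0 ≤ m * W × square (m * (+ 4 * m * m)) ≤ + 16384 * (square (m * W) * + r)
    core = fraction-bound k t W (+ r) (subst (_≤ + 64 * + suc t * W) 4m² 4m²≤64TW) T²≤4r
    numerator : + E * + suc k′ + - + V * m ≡ m * W
    numerator = trans (cong (λ x → + E * x + - + V * m) 4m²) (factor m (+ E) (+ V))
      where
      factor : ∀ m E V → E * (+ 4 * m * m) + - V * m ≡ m * (+ 4 * m * E - V)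
      factor = solve-∀
    denominator : + suc (k′ ℕ.+ k ℕ.* suc k′) ≡ m * (+ 4 * m * m)
    denominator = trans (pos-* (suc k) (suc k′)) (cong (m *_) 4m²)
    bound : square (+ suc (k′ ℕ.+ k ℕ.* suc k′)) ≤ + 16384 * (square (+ E * + suc k′ + - + V * m) * + r)
    bound = begin
      square (+ suc (k′ ℕ.+ k ℕ.* suc k′))                ≡⟨ cong square denominator ⟩
      square (m * (+ 4 * m * m))                          ≤⟨ proj₂ core ⟩
      + 16384 * (square (m * W) * + r)                    ≡⟨ cong (λ y → + 16384 * (square y * + r)) {m * W} {+ E * + suc k′ + - + V * m} (sym numerator) ⟩
      + 16384 * (square (+ E * + suc k′ + - + V * m) * + r) ∎
      where open ≤-Reasoning

  modularity-lower-bound : ∀ m E V t r → 1 ℕ.≤ m →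
    + (4 ℕ.* m ℕ.* m) ≤ + 64 * + suc t * (+ 4 * + m * + E - + V) → + suc t * + suc t ≤ + 4 * + r →
    c₀ /√ r ≤ (inv m ℚ.* toℚ E ℚ.- inv (4 ℕ.* m ℕ.* m) ℚ.* toℚ V)
  modularity-lower-bound (suc k) E V t r _ 4m²≤64TW T²≤4r =
    -- Transporting along suc-pred, rather than relying on conversion, keeps Agda from normalising inv d.
    subst (λ d → c₀ /√ r ≤ (inv (suc k) ℚ.* toℚ E ℚ.- inv d ℚ.* toℚ V)) 4m²≡
      (modularity-lower-bound-suc k (ℕ.pred (4 ℕ.* suc k ℕ.* suc k)) E V t r 4m²≡ (subst (λ d → + d ≤ + 64 * + suc t * (+ 4 * + suc k * + E - + V)) (sym 4m²≡) 4m²≤64TW) T²≤4r)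
    where
    4m²≡ : suc (ℕ.pred (4 ℕ.* suc k ℕ.* suc k)) ≡ 4 ℕ.* suc k ℕ.* suc k
    4m²≡ = ℕ.suc-pred (4 ℕ.* suc k ℕ.* suc k)

  modularity-gap : ∀ (m E V n r : ℕ) (T A s : ℤ) →
    + 2 * + m ≡ + r * + n → + 4 * + E ≡ + r * + n + A → + 2 * + V ≡ + r * + r * (+ n * + n + s * s) →
    + n * + n * + r ≤ + 32 * T * (+ n * A - + r * (s * s)) →
    + (4 ℕ.* m ℕ.* m) ≤ + 64 * T * (+ 4 * + m * + E - + V)
  modularity-gap m E V n r T A s 2m≡ 4E≡ 2V≡ Φ-large = subst (_≤ + 64 * T * (+ 4 * + m * + E - + V)) (sym 4m²) (0≤i-j⇒j≤i 0≤gap)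
    where
    gap = + 64 * T * (+ 4 * + m * + E - + V) - + 4 * + m * + m
    4m² : + (4 ℕ.* m ℕ.* m) ≡ + 4 * + m * + m
    4m² = trans (pos-* (4 ℕ.* m) m) (cong (_* + m) (pos-* 4 m))
    by-halves : ∀ m E V T → + 4 * (+ 64 * T * (+ 4 * m * E - V) - + 4 * m * m)
                          ≡ + 64 * T * (+ 2 * (+ 2 * m) * (+ 4 * E) - + 2 * (+ 2 * V)) - + 4 * (+ 2 * m) * (+ 2 * m)
    by-halves = solve-∀
    substituted : ∀ n r T A s → + 64 * T * (+ 2 * (r * n) * (r * n + A) - + 2 * (r * r * (n * n + s * s))) - + 4 * (r * n) * (r * n)
                              ≡ + 4 * r * (+ 32 * T * (n * A - r * (s * s)) - n * n * r)
    substituted = solve-∀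
    4gap : + 4 * gap ≡ + 4 * + r * (+ 32 * T * (+ n * A - + r * (s * s)) - + n * + n * + r)
    4gap = begin
      + 4 * gap
        ≡⟨ by-halves (+ m) (+ E) (+ V) T ⟩
      + 64 * T * (+ 2 * (+ 2 * + m) * (+ 4 * + E) - + 2 * (+ 2 * + V)) - + 4 * (+ 2 * + m) * (+ 2 * + m)
        ≡⟨ cong₂ (λ x y → + 64 * T * (+ 2 * x * y - + 2 * (+ 2 * + V)) - + 4 * x * x) 2m≡ 4E≡ ⟩
      + 64 * T * (+ 2 * (+ r * + n) * (+ r * + n + A) - + 2 * (+ 2 * + V)) - + 4 * (+ r * + n) * (+ r * + n)
        ≡⟨ cong (λ x → + 64 * T * (+ 2 * (+ r * + n) * (+ r * + n + A) - + 2 * x) - + 4 * (+ r * + n) * (+ r * + n)) 2V≡ ⟩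
      + 64 * T * (+ 2 * (+ r * + n) * (+ r * + n + A) - + 2 * (+ r * + r * (+ n * + n + s * s))) - + 4 * (+ r * + n) * (+ r * + n)
        ≡⟨ substituted (+ n) (+ r) T A s ⟩
      + 4 * + r * (+ 32 * T * (+ n * A - + r * (s * s)) - + n * + n * + r) ∎
      where open ≡-Reasoning
    0≤gap : + 0 ≤ gap
    0≤gap = *-cancelˡ-≤-pos (+ 0) gap (+ 4)
      (subst (+ 4 * + 0 ≤_) (sym 4gap) (0≤-* (0≤-* (0≤+ 4) (0≤+ r)) (i≤j⇒0≤j-i Φ-large)))

  edges-positive : ∀ m r n → + 2 * + m ≡ + r * + suc n → 1 ℕ.≤ r → 1 ℕ.≤ m
  edges-positive zero    (suc r) n () _
  edges-positive (suc m) _       _ _  _ = s≤s z≤n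

  threshold : ℕ → ℕ → ℕ
  threshold t r = 2 ℕ.+ 8 ℕ.* suc t ℕ.* (2 ℕ.* suc r ℕ.* (2 ℕ.* suc r))

  +-threshold : ∀ t r → + (8 ℕ.* suc t ℕ.* (2 ℕ.* suc r ℕ.* (2 ℕ.* suc r))) ≡ + 8 * + suc t * square (+ 2 * (+ 1 + + r))
  +-threshold t r = trans (pos-* (8 ℕ.* suc t) (2 ℕ.* suc r ℕ.* (2 ℕ.* suc r)))
    (cong₂ _*_ (pos-* 8 (suc t)) (trans (pos-* (2 ℕ.* suc r) (2 ℕ.* suc r)) (cong square (trans (pos-* 2 (suc r)) (cong (+ 2 *_) (pos-+ 1 r))))))

  √-bracket : ∀ r → 1 ℕ.≤ r → ∃[ t ] (r ℕ.≤ suc t ℕ.* suc t × suc t ℕ.* suc t ℕ.≤ 4 ℕ.* r)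
  √-bracket (suc zero)    _ = 0 , ℕ.≤-refl , s≤s z≤n
  √-bracket (suc (suc r)) _ with √-bracket (suc r) (s≤s z≤n)
  ... | t , lo , hi with suc (suc r) ℕ.≤? suc t ℕ.* suc t
  ...   | yes lo′ = t , lo′ , ℕ.≤-trans hi (ℕ.*-monoʳ-≤ 4 (ℕ.n≤1+n (suc r)))
  ...   | no  lo≰ = suc t , lo′ , hi′
    where
    T = suc t
    T²≡ : T ℕ.* T ≡ suc r
    T²≡ = ℕ.≤-antisym (ℕ.≤-pred (ℕ.≰⇒> lo≰)) lo
    expand : ∀ t → suc (suc t) ℕ.* suc (suc t) ≡ suc t ℕ.* suc t ℕ.+ (1 ℕ.+ 2 ℕ.* suc t)
    expand = ℕ-solve-∀
    lo′ : suc (suc r) ℕ.≤ suc T ℕ.* suc T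
    lo′ = begin
      suc (suc r)                     ≤⟨ ℕ.m≤m+n (suc (suc r)) (2 ℕ.* T) ⟩
      suc (suc r) ℕ.+ 2 ℕ.* T         ≡⟨ cong suc (sym (ℕ.+-suc r (2 ℕ.* T))) ⟩
      suc r ℕ.+ (1 ℕ.+ 2 ℕ.* T)       ≡⟨ cong (λ x → x ℕ.+ (1 ℕ.+ 2 ℕ.* T)) (sym T²≡) ⟩
      T ℕ.* T ℕ.+ (1 ℕ.+ 2 ℕ.* T)     ≡⟨ sym (expand t) ⟩
      suc T ℕ.* suc T                 ∎
      where open ℕ.≤-Reasoning
    hi′ : suc T ℕ.* suc T ℕ.≤ 4 ℕ.* suc (suc r)
    hi′ = begin
      suc T ℕ.* suc T                       ≡⟨ expand t ⟩
      T ℕ.* T ℕ.+ (1 ℕ.+ 2 ℕ.* T)           ≤⟨ ℕ.+-monoʳ-≤ (T ℕ.* T) (ℕ.+-monoʳ-≤ 1 (ℕ.*-monoʳ-≤ 2 (ℕ.m≤m*n T T))) ⟩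
      T ℕ.* T ℕ.+ (1 ℕ.+ 2 ℕ.* (T ℕ.* T))   ≡⟨ cong (λ x → x ℕ.+ (1 ℕ.+ 2 ℕ.* x)) T²≡ ⟩
      suc r ℕ.+ (1 ℕ.+ 2 ℕ.* suc r)         ≤⟨ ℕ.m≤m+n _ (r ℕ.+ 4) ⟩
      suc r ℕ.+ (1 ℕ.+ 2 ℕ.* suc r) ℕ.+ (r ℕ.+ 4) ≡⟨ slack r ⟩
      4 ℕ.* suc (suc r)                     ∎
      where
      open ℕ.≤-Reasoning
      slack : ∀ r → suc r ℕ.+ (1 ℕ.+ 2 ℕ.* suc r) ℕ.+ (r ℕ.+ 4) ≡ 4 ℕ.* suc (suc r)
      slack = ℕ-solve-∀

  module _ {n′ : ℕ} (G : Graph (suc (suc n′))) (r : ℕ) (regular : Regular G r) where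
    private
      n : ℕ
      n = suc (suc n′)

    rounded-partition : ∀ t (b₀ y : Vec Bool n) → 1 ℕ.≤ r → suc t ℕ.* suc t ℕ.≤ 4 ℕ.* r →
      + n * + n * + r ≤ + 32 * + suc t * Rounding.Φ G r regular b₀ y →
      c₀ /√ r ≤ q G (TwoParts.parts G r regular (λ v → Rounding.zᵇ G r regular b₀ v y))
    rounded-partition t b₀ y 1≤r T²≤4r Φ-large =
      modularity-lower-bound (edges G) (eIn G parts) (sumVolSq G parts) t r 1≤m
        (modularity-gap (edges G) (eIn G parts) (sumVolSq G parts) n r (+ suc t) (agreement y) (imbalance y)
                        edges-regular eIn-parts sumVolSq-parts Φ-large)
        (subst₂ _≤_ (pos-* (suc t) (suc t)) (pos-* 4 r) (+≤+ T²≤4r))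
      where
      open RegularGraph G r regular using (edges-regular)
      open Rounding G r regular b₀
      open TwoParts G r regular (λ v → zᵇ v y)
      1≤m : 1 ℕ.≤ edges G
      1≤m = edges-positive (edges G) r (suc n′) edges-regular 1≤r

    regular-graph-partition : ∀ t → 1 ℕ.≤ r → r ℕ.≤ suc t ℕ.* suc t → suc t ℕ.* suc t ℕ.≤ 4 ℕ.* r →
      threshold t r ℕ.≤ n → ∃[ P ] (c₀ /√ r ≤ q G P)
    regular-graph-partition t 1≤r r≤T² T²≤4r n-large = uncurry choose-rounding (RegularGraph.maxCut G r regular)
      where
      choose-rounding : ∀ b₀ → + r * + n ≤ + 4 * RegularGraph.cut G r regular b₀ → ∃[ P ] (c₀ /√ r ≤ q G P)
      choose-rounding b₀ cut-large = uncurry (λ y Φ-large → TwoParts.parts G r regular (λ v → Rounding.zᵇ G r regular b₀ v y) , rounded-partition t b₀ y 1≤r T²≤4r Φ-large)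
        (Rounding.good-rounding G r regular b₀ t
          (subst (+ r ≤_) (pos-* (suc t) (suc t)) (+≤+ r≤T²))
          (subst (_≤ + n) (+-threshold t r) (+≤+ (ℕ.≤-trans (ℕ.m≤n+m (8 ℕ.* suc t ℕ.* (2 ℕ.* suc r ℕ.* (2 ℕ.* suc r))) 2) n-large)))
          cut-large)

open import Defs
open import Data.Nat using (ℕ; zero; suc; s≤s; _≤_; _*_)
open import Data.Nat.Divisibility using (_∣_)
open import Data.Rational using (ℚ; 0ℚ; _<_)
open import Data.Product using (Σ-syntax; ∃-syntax; _×_; _,_)
open RegularGraphModularity using (c₀; 0<c₀; √-bracket; threshold; regular-graph-partition)

theorem1p5 : ∃[ c ] (0ℚ < c × (∀ (r : ℕ) → 1 ≤ r → ∃[ N ] (∀ (n : ℕ) → N ≤ n → 2 ∣ r * n →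
    ∀ (G : Graph n) → Regular G r → ∃[ P ] (c /√ r ≤ q G P))))
-- The parity of r n only matters for the existence of an r-regular graph on n vertices.
theorem1p5 = c₀ , 0<c₀ , λ r 1≤r → let t , r≤T² , T²≤4r = √-bracket r 1≤r in
  threshold t r , λ where
    (suc (suc _)) n-large _ G regular → regular-graph-partition G r regular t 1≤r r≤T² T²≤4r n-large
    zero          ()
    (suc zero)    (s≤s ())
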